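{- Any concrete instance $H$ of a $!$-graph $G$ has an instantiation in expansion-normal form, i.e. a finite sequence consisting only of $\mathrm{EXP}$ and $\mathrm{KILL}$ operations, each of depth $0$ at the point it is applied, which transforms $G$ into a graph isomorphic to $H$.
   Context: Fix a compressed monoidal signature $T=(O,M,\mathrm{dom},\mathrm{cod})$, $\mathrm{dom},\mathrm{cod}: M \rightarrow (O\times\{\mathsf{v},\mathsf{f}\})^*$. The derived compressed typegraph $\mathcal{G}_T$ has vertex set $O\sqcup M$, a self-loop on each $X\in O$, an edge $\mathrm{in}^a_{f,i}$ from $X$ to $f$ for each $f\in M$ and index $i$ with $\mathrm{dom}(f)[i]=(X,a)$, and an edge $\mathrm{out}^a_{f,j}$ from $f$ to $X$ for each index $j$ with $\mathrm{cod}(f)[j]=(X,a)$. $\mathcal{G}_{T!}$ is $\mathcal{G}_T$ plus a vertex $!$, a self-loop on $!$, and an edge from $!$ to each vertex of $\mathcal{G}_T$. For a finite directed multigraph $G$ typed over $\mathcal{G}_{T!}$, vertices typed in $O$, $M$, $!$ are wire-, node-, $!$-vertices; fixed-arity edges are those typed by an $\mathsf{f}$-tagged edge; $U$ deletes $!$-vertices and incident edges. A string graph is a $\mathcal{G}_T$-typed graph whose typing restricts at each node-vertex to a bijection on incident fixed-arity edges and whose wire-vertices have at most one incoming and one outgoing edge. An open subgraph $O'$ of a string graph $K$ is a string subgraph with no vertex adjacent to a wire-vertex outside $O'$ and no incident fixed-arity edge outside $O'$. $B(b)$ is the full subgraph on successors of a $!$-vertex $b$, $\beta(G)$ the full subgraph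 on $!$-vertices. A $!$-graph is a $\mathcal{G}_{T!}$-typed graph with $U(G)$ a string graph, $\beta(G)$ posetal (at most one edge between two vertices, edge relation a partial order), $U(B(b))$ open in $U(G)$ for each $!$-vertex $b$, and $B(b')\subseteq B(b)$ whenever $b'\in B(b)$; it is concrete if it has no $!$-vertices. Writing $G\setminus H$ for the full subgraph on vertices not in $H$, the $!$-box operations at a $!$-vertex $b$ are: $\mathrm{COPY}_b(G)$, the pushout in $\mathbf{Graph}/\mathcal{G}_{T!}$ of $G\hookleftarrow G\setminus B(b)\hookrightarrow G$ (in which $b$ has two copies $b^0,b^1$, its images under the two coprojections); $\mathrm{DROP}_b(G)=G\setminus\{b\}$; $\mathrm{KILL}_b(G) = G\setminus B(b)$. $\mathrm{EXP}_b$ abbreviates $\mathrm{COPY}_b$ followed by $\mathrm{DROP}_{b^1}$. An instantiation of $H$ from $G$ is a finite sequence of operations, each applied to a $!$-vertex of the current graph, starting from $G$ and yielding a graph isomorphic to $H$; $H$ is a (concrete) instance of $G$ if such a sequence exists (and $H$ is concrete). The depth of a $!$-vertex $b$ is $\delta(b)=0$ if $b$ has no predecessors other than itself, and otherwise $1+\max\{\delta(c): c\neq b,\ c\text{ has an edge to } b\}$; the depth of an operation (including $\mathrm{EXP}_b$) is the depth of the $!$-vertex it acts on in the graph to which it is applied. -}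

module Defs where

open import Data.Bool using (Bool; true; false; T; not; _∧_; _∨_)
open import Data.Bool.Properties using (T-irrelevant)
open import Data.Empty using (⊥-elim)
open import Data.Unit using (tt)
open import Data.Fin using (Fin)
open import Data.List using (List; []; _∷_; map; _++_; length; lookup)
open import Data.Bool.ListAction using (any)
open import Data.List.Membership.Propositional using (_∈_)
open import Data.List.Membership.Propositional.Properties using (∈-map⁺; ∈-++⁺ˡ; ∈-++⁺ʳ)
open import Data.List.Relation.Unary.Any using (here; there)
open import Data.Product using (Σ; _×_; _,_; proj₁; proj₂)
open import Data.Sum using (_⊎_; inj₁; inj₂)
import Data.Sum.Properties as SumP
open import Function using (_∘_)
open import Function.Bundles using (_↔_; Inverse)
open import Relation.Binary.Definitions using (DecidableEquality)
open import Relation.Binary.PropositionalEquality using (_≡_; refl; sym; trans; cong)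
open import Relation.Nullary using (Dec; yes; no)
open import Relation.Nullary.Decidable using (⌊_⌋; T?)

sublist : {A : Set} (p : A → Bool) → List A → List (Σ A (T ∘ p))
sublist p [] = []
sublist p (x ∷ xs) with T? (p x)
... | yes px = (x , px) ∷ sublist p xs
... | no _ = sublist p xs

sublist-complete : {A : Set} (p : A → Bool) (xs : List A) (x : A) (px : T (p x)) →
                   x ∈ xs → (x , px) ∈ sublist p xs
sublist-complete p (y ∷ xs) .y px (here refl) with T? (p y)
... | yes q = here (cong (y ,_) (T-irrelevant px q))
... | no ¬q = ⊥-elim (¬q px)
sublist-complete p (y ∷ xs) x px (there m) with T? (p y)
... | yes _ = there (sublist-complete p xs x px m)
... | no _ = sublist-complete p xs x px m

Σ-dec : {A : Set} (p : A → Bool) → DecidableEquality A → DecidableEquality (Σ A (T ∘ p))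
Σ-dec p _≟_ (x , px) (y , py) with x ≟ y
... | yes refl = yes (cong (x ,_) (T-irrelevant px py))
... | no ne = no (λ eq → ne (cong proj₁ eq))

∧-l : ∀ a b → T (a ∧ b) → T a
∧-l true b _ = tt

∧-r : ∀ a b → T (a ∧ b) → T b
∧-r true b t = t

data Tag : Set where
  vTag fTag : Tag          -- v (variable arity) and f (fixed arity)

record Sig : Set₁ where
  field
    O M : Set
    dom cod : M → List (O × Tag)

module _ (S : Sig) where
  open Sig S

  data VT : Set where
    wv : O → VT
    nv : M → VT
    bv : VT

  data ET : Set where
    loopW : O → ET
    inE   : (f : M) → Fin (length (dom f)) → ET
    outE  : (f : M) → Fin (length (cod f)) → ET
    loopB : ET
    bW    : O → ET
    bN    : M → ET

  tsrc : ET → VT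
  tsrc (loopW X) = wv X
  tsrc (inE f i) = wv (proj₁ (lookup (dom f) i))
  tsrc (outE f j) = nv f
  tsrc loopB = bv
  tsrc (bW X) = bv
  tsrc (bN f) = bv

  ttgt : ET → VT
  ttgt (loopW X) = wv X
  ttgt (inE f i) = nv f
  ttgt (outE f j) = wv (proj₁ (lookup (cod f) j))
  ttgt loopB = bv
  ttgt (bW X) = wv X
  ttgt (bN f) = nv f

  -- A finite directed multigraph typed over G_{T!}.
  -- Finiteness: vertex and edge sets are listable (complete lists) with
  -- decidable equality (i.e. in bijection with some Fin n).
  record Graph : Set₁ where
    field
      V E     : Set
      src tgt : E → V
      vty     : V → VT
      ety     : E → ET
      src-ty  : ∀ e → tsrc (ety e) ≡ vty (src e)
      tgt-ty  : ∀ e → ttgt (ety e) ≡ vty (tgt e)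
      _≟V_    : DecidableEquality V
      _≟E_    : DecidableEquality E
      vlist   : List V
      vall    : ∀ v → v ∈ vlist
      elist   : List E
      eall    : ∀ e → e ∈ elist

module _ {S : Sig} where
  open Sig S
  open Graph

  isBangT : VT S → Bool
  isBangT bv = true
  isBangT _  = false

  isWireT : VT S → Bool
  isWireT (wv _) = true
  isWireT _      = false

  data FixedAt (f : M) : ET S → Set where
    fin  : ∀ i → proj₂ (lookup (dom f) i) ≡ fTag → FixedAt f (inE f i)
    fout : ∀ j → proj₂ (lookup (cod f) j) ≡ fTag → FixedAt f (outE f j)

  data Fixed : ET S → Set where
    fixed : ∀ {f t} → FixedAt f t → Fixed t

  isBang : (G : Graph S) → V G → Bool
  isBang G v = isBangT (vty G v)

  Edge : (G : Graph S) → V G → V G → Set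
  Edge G u v = Σ (E G) λ e → src G e ≡ u × tgt G e ≡ v

  inB : (G : Graph S) → V G → V G → Bool
  inB G b v = any (λ e → ⌊ _≟V_ G (src G e) b ⌋ ∧ ⌊ _≟V_ G (tgt G e) v ⌋) (elist G)

  fullSub : (G : Graph S) → (V G → Bool) → Graph S
  fullSub G keep = record
    { V = Σ (V G) (T ∘ keep)
    ; E = Σ (E G) (T ∘ ke)
    ; src = λ { (e , p) → src G e , ∧-l (keep (src G e)) _ p }
    ; tgt = λ { (e , p) → tgt G e , ∧-r (keep (src G e)) _ p }
    ; vty = λ { (v , _) → vty G v }
    ; ety = λ { (e , _) → ety G e }
    ; src-ty = λ { (e , _) → src-ty G e }
    ; tgt-ty = λ { (e , _) → tgt-ty G e }
    ; _≟V_ = Σ-dec keep (_≟V_ G)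
    ; _≟E_ = Σ-dec ke (_≟E_ G)
    ; vlist = sublist keep (vlist G)
    ; vall = λ { (v , p) → sublist-complete keep (vlist G) v p (vall G v) }
    ; elist = sublist ke (elist G)
    ; eall = λ { (e , p) → sublist-complete ke (elist G) e p (eall G e) }
    }
    where
      ke : E G → Bool
      ke e = keep (src G e) ∧ keep (tgt G e)

  U : Graph S → Graph S
  U G = fullSub G (λ v → not (isBang G v))

  -- COPY_b(G): explicit pushout of G ← G∖B(b) → G.  Vertices: G plus a
  -- second copy of B(b); edges: G plus a second copy of each edge with
  -- an endpoint in B(b).  b^0 = inj₁ b, b^1 = inj₂ (b , _).
  COPY : (G : Graph S) → V G → Graph S
  COPY G b = record
    { V = V G ⊎ Σ (V G) (T ∘ inb)
    ; E = E G ⊎ Σ (E G) (T ∘ ke)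
    ; src = λ { (inj₁ e) → inj₁ (src G e) ; (inj₂ (e , _)) → emb (src G e) }
    ; tgt = λ { (inj₁ e) → inj₁ (tgt G e) ; (inj₂ (e , _)) → emb (tgt G e) }
    ; vty = vty′
    ; ety = λ { (inj₁ e) → ety G e ; (inj₂ (e , _)) → ety G e }
    ; src-ty = λ { (inj₁ e) → src-ty G e
                 ; (inj₂ (e , _)) → trans (src-ty G e) (sym (emb-ty (src G e))) }
    ; tgt-ty = λ { (inj₁ e) → tgt-ty G e
                 ; (inj₂ (e , _)) → trans (tgt-ty G e) (sym (emb-ty (tgt G e))) }
    ; _≟V_ = SumP.≡-dec (_≟V_ G) (Σ-dec inb (_≟V_ G))
    ; _≟E_ = SumP.≡-dec (_≟E_ G) (Σ-dec ke (_≟E_ G))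
    ; vlist = map inj₁ (vlist G) ++ map inj₂ (sublist inb (vlist G))
    ; vall = λ { (inj₁ v) → ∈-++⁺ˡ (∈-map⁺ inj₁ (vall G v))
               ; (inj₂ (v , p)) → ∈-++⁺ʳ (map inj₁ (vlist G))
                   (∈-map⁺ inj₂ (sublist-complete inb (vlist G) v p (vall G v))) }
    ; elist = map inj₁ (elist G) ++ map inj₂ (sublist ke (elist G))
    ; eall = λ { (inj₁ e) → ∈-++⁺ˡ (∈-map⁺ inj₁ (eall G e))
               ; (inj₂ (e , p)) → ∈-++⁺ʳ (map inj₁ (elist G))
                   (∈-map⁺ inj₂ (sublist-complete ke (elist G) e p (eall G e))) }
    }
    where
      inb : V G → Bool
      inb = inB G b
      ke : E G → Bool
      ke e = inb (src G e) ∨ inb (tgt G e)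
      V′ : Set
      V′ = V G ⊎ Σ (V G) (T ∘ inb)
      vty′ : V′ → VT S
      vty′ (inj₁ v) = vty G v
      vty′ (inj₂ (v , _)) = vty G v
      emb : V G → V′
      emb v with T? (inb v)
      ... | yes p = inj₂ (v , p)
      ... | no _ = inj₁ v
      emb-ty : ∀ v → vty′ (emb v) ≡ vty G v
      emb-ty v with T? (inb v)
      ... | yes p = refl
      ... | no _ = refl

  DROP : (G : Graph S) → V G → Graph S
  DROP G b = fullSub G (λ v → not ⌊ _≟V_ G v b ⌋)

  KILL : (G : Graph S) → V G → Graph S
  KILL G b = fullSub G (λ v → not (inB G b v))

  -- EXP_b = COPY_b followed by DROP_{b^1}; b^1 exists when b ∈ B(b)
  EXP : (G : Graph S) → (b : V G) → T (inB G b b) → Graph S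
  EXP G b p = DROP (COPY G b) (inj₂ (b , p))

  record Iso (G H : Graph S) : Set where
    field
      fV : V G ↔ V H
      fE : E G ↔ E H
      pres-src : ∀ e → src H (Inverse.to fE e) ≡ Inverse.to fV (src G e)
      pres-tgt : ∀ e → tgt H (Inverse.to fE e) ≡ Inverse.to fV (tgt G e)
      pres-vty : ∀ v → vty H (Inverse.to fV v) ≡ vty G v
      pres-ety : ∀ e → ety H (Inverse.to fE e) ≡ ety G e

  Incident : (G : Graph S) → E G → V G → Set
  Incident G e v = src G e ≡ v ⊎ tgt G e ≡ v

  IsStringGraph : Graph S → Set
  IsStringGraph K =
    -- typed over G_T: no !-vertices
    (∀ v → isBang K v ≡ false) ×
    -- at each node-vertex the typing is a bijection from incident
    -- fixed-arity edges onto the fixed-arity edges of G_T at f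
    (∀ v f → vty K v ≡ nv f → ∀ t → FixedAt f t →
       Σ (E K) (λ e → Incident K e v × ety K e ≡ t) ×
       (∀ e e′ → Incident K e v → ety K e ≡ t →
                 Incident K e′ v → ety K e′ ≡ t → e ≡ e′)) ×
    (∀ w → T (isWireT (vty K w)) →
       (∀ e e′ → tgt K e ≡ w → tgt K e′ ≡ w → e ≡ e′) ×
       (∀ e e′ → src K e ≡ w → src K e′ ≡ w → e ≡ e′))

  IsOpen : (K : Graph S) → (V K → Bool) → Set
  IsOpen K keep =
    IsStringGraph (fullSub K keep) ×
    (∀ e → T (keep (src K e)) → T (isWireT (vty K (tgt K e))) → T (keep (tgt K e))) ×
    (∀ e → T (keep (tgt K e)) → T (isWireT (vty K (src K e))) → T (keep (src K e))) ×
    (∀ e → Fixed (ety K e) → T (keep (src K e)) ⊎ T (keep (tgt K e)) →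
       T (keep (src K e)) × T (keep (tgt K e)))

  IsBangGraph : Graph S → Set
  IsBangGraph G =
    IsStringGraph (U G) ×
    -- β(G) posetal
    ((∀ b → T (isBang G b) → Edge G b b) ×
     (∀ e e′ → T (isBang G (src G e)) → T (isBang G (tgt G e)) →
        src G e ≡ src G e′ → tgt G e ≡ tgt G e′ → e ≡ e′) ×
     (∀ a b c → T (isBang G a) → T (isBang G b) → T (isBang G c) →
        Edge G a b → Edge G b c → Edge G a c) ×
     (∀ a b → T (isBang G a) → T (isBang G b) →
        Edge G a b → Edge G b a → a ≡ b)) ×
    (∀ b → T (isBang G b) →
       IsOpen (U G) (λ v → inB G b (proj₁ v))) ×
    (∀ b b′ → T (isBang G b) → T (isBang G b′) → Edge G b b′ →
       ∀ v → Edge G b′ v → Edge G b v)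

  IsConcrete : Graph S → Set
  IsConcrete G = ∀ v → isBang G v ≡ false

  data Op (G : Graph S) : Set where
    copy drop kill : (b : V G) → T (isBang G b) → Op G

  apply : (G : Graph S) → Op G → Graph S
  apply G (copy b _) = COPY G b
  apply G (drop b _) = DROP G b
  apply G (kill b _) = KILL G b

  data Instantiation : Graph S → Graph S → Set₁ where
    done : ∀ {G H} → Iso G H → Instantiation G H
    step : ∀ {G H} (o : Op G) → Instantiation (apply G o) H → Instantiation G H

  Depth0 : (G : Graph S) → V G → Set
  Depth0 G b = ∀ e → tgt G e ≡ b → src G e ≡ b

  data ENFInstantiation : Graph S → Graph S → Set₁ where
    done : ∀ {G H} → Iso G H → ENFInstantiation G H
    exp  : ∀ {G H} (b : V G) → T (isBang G b) → Depth0 G b →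
           (p : T (inB G b b)) → ENFInstantiation (EXP G b p) H →
           ENFInstantiation G H
    kill : ∀ {G H} (b : V G) → T (isBang G b) → Depth0 G b →
           ENFInstantiation (KILL G b) H → ENFInstantiation G H

module Submission where

-- The proof normalises a given instantiation from its last operation
-- backwards.  Having turned the remainder into an ENF instantiation r of H
-- from op(G), the operation op on the !-vertex b is pushed into r: if b
-- has depth 0 in G, KILL_b is already an ENF step and DROP_b is EXP_b
-- followed by KILL of the first copy; otherwise the first step of r, on a
-- depth-0 vertex c, is moved in front of op by one of the commutation
-- isomorphisms, and op (or, when EXP_c duplicates b, one op per copy of b)
-- is pushed further.  This terminates by induction on the length of r and on
-- the number of strict predecessors of b, which drops for the second copy.
--
-- Graphs are compared up to isomorphism throughout, so every
-- commutation lemma is an explicit isomorphism along which ENF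
-- instantiations are transported.

open import Defs
open import Data.Bool using (Bool; true; false; T; not; _∧_; _∨_)
open import Data.Bool.Properties using (T-irrelevant; ∧-comm)
open import Data.Empty using (⊥; ⊥-elim)
open import Data.Unit using (tt)
open import Data.Nat using (ℕ; zero; suc; _≤_; _<_; z≤n; s≤s)
open import Data.Nat.Properties using (≤-refl; ≤-trans; ≤-reflexive; ≤-pred; m≤n⇒m≤1+n)
open import Data.List using (List; []; _∷_; map; length)
open import Data.List.Properties using (length-map)
open import Data.List.Membership.Propositional using (_∈_)
open import Data.List.Membership.Propositional.Properties using (∈-map⁺)
open import Data.List.Relation.Unary.Any using (here; there; any?)
import Data.List.Relation.Unary.Any as Any
import Data.List.Relation.Unary.Any.Properties as AnyP
open import Data.Product using (Σ; _×_; _,_; proj₁; proj₂)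
open import Data.Sum using (_⊎_; inj₁; inj₂)
open import Data.Sum.Properties using (inj₁-injective; inj₂-injective)
open import Function using (_∘_; id)
open import Function.Bundles using (Inverse; mk↔ₛ′)
open import Relation.Binary.PropositionalEquality
open import Relation.Nullary using (Dec; yes; no; ¬_)
open import Relation.Nullary.Decidable using (⌊_⌋; T?; toWitness; fromWitness; ¬?; _×-dec_)

T-∧⁺ : ∀ {a b} → T a → T b → T (a ∧ b)
T-∧⁺ {true} {true} _ _ = tt

T-∨⁻ : ∀ {a b} → T (a ∨ b) → T a ⊎ T b
T-∨⁻ {true} _ = inj₁ tt
T-∨⁻ {false} t = inj₂ t

T-∨⁺ˡ : ∀ {a b} → T a → T (a ∨ b)
T-∨⁺ˡ {true} _ = tt

T-∨⁺ʳ : ∀ {a b} → T b → T (a ∨ b)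
T-∨⁺ʳ {true} _ = tt
T-∨⁺ʳ {false} t = t

¬T-∨ : ∀ {a b} → ¬ T a → ¬ T b → ¬ T (a ∨ b)
¬T-∨ {true} na _ t = na t
¬T-∨ {false} _ nb t = nb t

T-not⁺ : ∀ {a} → ¬ T a → T (not a)
T-not⁺ {true} n = n tt
T-not⁺ {false} _ = tt

T-not⁻ : ∀ {a} → T (not a) → ¬ T a
T-not⁻ {true} () _
T-not⁻ {false} _ ()

¬T⇒≡false : ∀ {a} → ¬ T a → a ≡ false
¬T⇒≡false {true} n = ⊥-elim (n tt)
¬T⇒≡false {false} _ = refl

∧-T⇒ : ∀ {a} b → T a → a ∧ b ≡ b
∧-T⇒ {true} b _ = refl

T⇒≡true : ∀ {a} → T a → a ≡ true
T⇒≡true {true} _ = refl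

T-ext : ∀ {a b} → (T a → T b) → (T b → T a) → a ≡ b
T-ext {true} {true} _ _ = refl
T-ext {true} {false} f _ = ⊥-elim (f tt)
T-ext {false} {true} _ g = ⊥-elim (g tt)
T-ext {false} {false} _ _ = refl

ΣT-≡ : {A : Set} {p : A → Bool} {x y : Σ A (T ∘ p)} → proj₁ x ≡ proj₁ y → x ≡ y
ΣT-≡ {x = x , s} {.x , t} refl = cong (x ,_) (T-irrelevant s t)

inj₁≢inj₂ : {A B : Set} {x : A} {y : B} → inj₁ x ≢ inj₂ y
inj₁≢inj₂ ()

module _ {S : Sig} where
  open Graph

  InBox : (G : Graph S) → V G → V G → Set
  InBox G b v = T (inB G b v)

  Bang : (G : Graph S) → V G → Set
  Bang G v = T (isBang G v)

  inB⇒Edge : (G : Graph S) (b v : V G) → InBox G b v → Edge G b v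
  inB⇒Edge G b v t with Any.satisfied (AnyP.any⁻ _ (elist G) t)
  ... | e , q = e , toWitness {a? = _≟V_ G (src G e) b} (∧-l _ _ q)
                , toWitness {a? = _≟V_ G (tgt G e) v} (∧-r _ _ q)

  Edge⇒inB : (G : Graph S) (b v : V G) → Edge G b v → InBox G b v
  Edge⇒inB G b v (e , refl , refl) =
    AnyP.any⁺ _ (Any.map (λ { refl → T-∧⁺ (fromWitness {a? = _≟V_ G (src G e) (src G e)} refl)
                                        (fromWitness {a? = _≟V_ G (tgt G e) (tgt G e)} refl) }) (eall G e))

  typed-bang-pred : (t : ET S) → ttgt S t ≡ bv → tsrc S t ≡ bv
  typed-bang-pred loopB _ = refl
  typed-bang-pred (loopW _) ()
  typed-bang-pred (inE _ _) ()
  typed-bang-pred (outE _ _) ()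
  typed-bang-pred (bW _) ()
  typed-bang-pred (bN _) ()

  isBangT⇒bv : ∀ {t} → T (isBangT {S} t) → t ≡ bv
  isBangT⇒bv {bv} _ = refl

  bv⇒isBangT : ∀ {t} → t ≡ bv → T (isBangT {S} t)
  bv⇒isBangT refl = tt

  box-bang : (G : Graph S) (a b : V G) → Bang G b → InBox G a b → Bang G a
  box-bang G a b bb x with inB⇒Edge G a b x
  ... | e , refl , refl = bv⇒isBangT
    (trans (sym (src-ty G e)) (typed-bang-pred (ety G e) (trans (tgt-ty G e) (isBangT⇒bv bb))))

module _ {S : Sig} where
  open Graph

  record Iso′ (G H : Graph S) : Set where
    field
      fv : V G → V H
      gv : V H → V G
      fvgv : ∀ y → fv (gv y) ≡ y
      gvfv : ∀ x → gv (fv x) ≡ x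
      fe : E G → E H
      ge : E H → E G
      fege : ∀ y → fe (ge y) ≡ y
      gefe : ∀ x → ge (fe x) ≡ x
      psrc : ∀ e → src H (fe e) ≡ fv (src G e)
      ptgt : ∀ e → tgt H (fe e) ≡ fv (tgt G e)
      pvty : ∀ v → vty H (fv v) ≡ vty G v
      pety : ∀ e → ety H (fe e) ≡ ety G e
  open Iso′ public

  toIso : {G H : Graph S} → Iso′ G H → Iso G H
  toIso I = record
    { fV = mk↔ₛ′ (fv I) (gv I) (fvgv I) (gvfv I)
    ; fE = mk↔ₛ′ (fe I) (ge I) (fege I) (gefe I)
    ; pres-src = psrc I ; pres-tgt = ptgt I ; pres-vty = pvty I ; pres-ety = pety I }

  fromIso : {G H : Graph S} → Iso G H → Iso′ G H
  fromIso I = record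
    { fv = Inverse.to (Iso.fV I) ; gv = Inverse.from (Iso.fV I)
    ; fvgv = Inverse.strictlyInverseˡ (Iso.fV I) ; gvfv = Inverse.strictlyInverseʳ (Iso.fV I)
    ; fe = Inverse.to (Iso.fE I) ; ge = Inverse.from (Iso.fE I)
    ; fege = Inverse.strictlyInverseˡ (Iso.fE I) ; gefe = Inverse.strictlyInverseʳ (Iso.fE I)
    ; psrc = Iso.pres-src I ; ptgt = Iso.pres-tgt I ; pvty = Iso.pres-vty I ; pety = Iso.pres-ety I }

  isoRefl : (G : Graph S) → Iso′ G G
  isoRefl G = record { fv = id ; gv = id ; fvgv = λ _ → refl ; gvfv = λ _ → refl
    ; fe = id ; ge = id ; fege = λ _ → refl ; gefe = λ _ → refl
    ; psrc = λ _ → refl ; ptgt = λ _ → refl ; pvty = λ _ → refl ; pety = λ _ → refl }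

  isoSym : {G H : Graph S} → Iso′ G H → Iso′ H G
  isoSym {G} {H} I = record { fv = gv I ; gv = fv I ; fvgv = gvfv I ; gvfv = fvgv I
    ; fe = ge I ; ge = fe I ; fege = gefe I ; gefe = fege I
    ; psrc = λ e → trans (sym (gvfv I _)) (cong (gv I) (trans (sym (psrc I (ge I e))) (cong (src H) (fege I e))))
    ; ptgt = λ e → trans (sym (gvfv I _)) (cong (gv I) (trans (sym (ptgt I (ge I e))) (cong (tgt H) (fege I e))))
    ; pvty = λ v → trans (sym (pvty I (gv I v))) (cong (vty H) (fvgv I v))
    ; pety = λ e → trans (sym (pety I (ge I e))) (cong (ety H) (fege I e)) }

  isoTrans : {G H K : Graph S} → Iso′ G H → Iso′ H K → Iso′ G K
  isoTrans {G} {H} {K} I J = record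
    { fv = fv J ∘ fv I ; gv = gv I ∘ gv J
    ; fvgv = λ y → trans (cong (fv J) (fvgv I _)) (fvgv J y)
    ; gvfv = λ x → trans (cong (gv I) (gvfv J _)) (gvfv I x)
    ; fe = fe J ∘ fe I ; ge = ge I ∘ ge J
    ; fege = λ y → trans (cong (fe J) (fege I _)) (fege J y)
    ; gefe = λ x → trans (cong (ge I) (gefe J _)) (gefe I x)
    ; psrc = λ e → trans (psrc J (fe I e)) (cong (fv J) (psrc I e))
    ; ptgt = λ e → trans (ptgt J (fe I e)) (cong (fv J) (ptgt I e))
    ; pvty = λ v → trans (pvty J (fv I v)) (pvty I v)
    ; pety = λ e → trans (pety J (fe I e)) (pety I e) }

  fv-injective : {G H : Graph S} (I : Iso′ G H) {x y : V G} → fv I x ≡ fv I y → x ≡ y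
  fv-injective I {x} {y} eq = trans (sym (gvfv I x)) (trans (cong (gv I) eq) (gvfv I y))

  iso-Edge : {G H : Graph S} (I : Iso′ G H) {a b : V G} → Edge G a b → Edge H (fv I a) (fv I b)
  iso-Edge I (e , refl , refl) = fe I e , psrc I e , ptgt I e

  iso-inB : {G H : Graph S} (I : Iso′ G H) (a b : V G) → inB H (fv I a) (fv I b) ≡ inB G a b
  iso-inB {G} {H} I a b = T-ext
    (λ t → Edge⇒inB G a b (subst₂ (Edge G) (gvfv I a) (gvfv I b) (iso-Edge (isoSym I) (inB⇒Edge H _ _ t))))
    (λ t → Edge⇒inB H _ _ (iso-Edge I (inB⇒Edge G a b t)))

  iso-isBang : {G H : Graph S} (I : Iso′ G H) (a : V G) → isBang H (fv I a) ≡ isBang G a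
  iso-isBang I a = cong isBangT (pvty I a)

  iso-≟ : {G H : Graph S} (I : Iso′ G H) (a b : V G) → ⌊ _≟V_ H (fv I a) (fv I b) ⌋ ≡ ⌊ _≟V_ G a b ⌋
  iso-≟ {G} {H} I a b = T-ext (λ t → fromWitness {a? = _≟V_ G a b} (fv-injective I (toWitness {a? = _≟V_ H _ _} t)))
                                  (λ t → fromWitness {a? = _≟V_ H _ _} (cong (fv I) (toWitness {a? = _≟V_ G a b} t)))

  fullSub-cong : {G H : Graph S} (I : Iso′ G H) (k : V G → Bool) (k' : V H → Bool) →
         (∀ v → k' (fv I v) ≡ k v) → Iso′ (fullSub G k) (fullSub H k')
  fullSub-cong {G} {H} I k k' eq = record
    { fv = λ { (v , p) → fv I v , subst T (sym (eq v)) p }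
    ; gv = λ { (w , p) → gv I w , subst T (eq' w) p }
    ; fvgv = λ { (w , p) → ΣT-≡ {p = k'} (fvgv I w) }
    ; gvfv = λ { (v , p) → ΣT-≡ {p = k} (gvfv I v) }
    ; fe = λ { (e , p) → fe I e , subst T (eqE e) p }
    ; ge = λ { (e , p) → ge I e , subst T (sym (eqE (ge I e))) (subst T (cong ke' (sym (fege I e))) p) }
    ; fege = λ { (e , p) → ΣT-≡ {p = ke'} (fege I e) }
    ; gefe = λ { (e , p) → ΣT-≡ {p = ke} (gefe I e) }
    ; psrc = λ { (e , p) → ΣT-≡ {p = k'} (psrc I e) }
    ; ptgt = λ { (e , p) → ΣT-≡ {p = k'} (ptgt I e) }
    ; pvty = λ { (v , p) → pvty I v }
    ; pety = λ { (e , p) → pety I e } }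
    where
      eq' : ∀ w → k' w ≡ k (gv I w)
      eq' w = trans (cong k' (sym (fvgv I w))) (eq (gv I w))
      ke : E G → Bool
      ke e = k (src G e) ∧ k (tgt G e)
      ke' : E H → Bool
      ke' e = k' (src H e) ∧ k' (tgt H e)
      eqE : ∀ e → ke e ≡ ke' (fe I e)
      eqE e = cong₂ _∧_ (trans (sym (eq _)) (cong k' (sym (psrc I e)))) (trans (sym (eq _)) (cong k' (sym (ptgt I e))))

  fullSub-fullSub : (G : Graph S) (k1 : V G → Bool) (k2 : V (fullSub G k1) → Bool) (k : V G → Bool) →
          (∀ v → T (k v) → T (k1 v)) → (∀ v p → k2 (v , p) ≡ k v) →
          Iso′ (fullSub (fullSub G k1) k2) (fullSub G k)
  fullSub-fullSub G k1 k2 k hk hk2 = record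
    { fv = λ { ((v , p) , q) → v , subst T (hk2 v p) q }
    ; gv = λ { (v , r) → (v , hk v r) , subst T (sym (hk2 v (hk v r))) r }
    ; fvgv = λ { (v , r) → ΣT-≡ {p = k} refl }
    ; gvfv = λ { ((v , p) , q) → ΣT-≡ {p = k2} (ΣT-≡ {p = k1} refl) }
    ; fe = λ { ((e , p) , q) → e , T-∧⁺ (subst T (hk2 _ _) (∧-l _ _ q)) (subst T (hk2 _ _) (∧-r _ _ q)) }
    ; ge = λ { (e , r) → (e , T-∧⁺ (hk _ (∧-l _ _ r)) (hk _ (∧-r _ _ r))) ,
                          T-∧⁺ (subst T (sym (hk2 _ _)) (∧-l _ _ r)) (subst T (sym (hk2 _ _)) (∧-r _ _ r)) }
    ; fege = λ { (e , r) → ΣT-≡ {p = ke} refl }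
    ; gefe = λ { ((e , p) , q) → ΣT-≡ {p = ke2} (ΣT-≡ {p = ke1} refl) }
    ; psrc = λ { ((e , p) , q) → ΣT-≡ {p = k} refl }
    ; ptgt = λ { ((e , p) , q) → ΣT-≡ {p = k} refl }
    ; pvty = λ _ → refl
    ; pety = λ _ → refl }
    where
      ke : E G → Bool
      ke e = k (src G e) ∧ k (tgt G e)
      ke1 : E G → Bool
      ke1 e = k1 (src G e) ∧ k1 (tgt G e)
      G1 : Graph S
      G1 = fullSub G k1
      ke2 : E G1 → Bool
      ke2 e = k2 (src G1 e) ∧ k2 (tgt G1 e)

  fullSub-ext : (G : Graph S) (k k' : V G → Bool) → (∀ v → k' v ≡ k v) → Iso′ (fullSub G k) (fullSub G k')
  fullSub-ext G k k' eq = fullSub-cong (isoRefl G) k k' eq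

  fullSub-all : (G : Graph S) (k : V G → Bool) → (∀ v → T (k v)) → Iso′ (fullSub G k) G
  fullSub-all G k all = record
    { fv = proj₁ ; gv = λ v → v , all v ; fvgv = λ _ → refl ; gvfv = λ { (v , p) → ΣT-≡ {p = k} refl }
    ; fe = proj₁ ; ge = λ e → e , T-∧⁺ (all _) (all _) ; fege = λ _ → refl
    ; gefe = λ { (e , p) → ΣT-≡ {p = λ e → k (src G e) ∧ k (tgt G e)} refl }
    ; psrc = λ _ → refl ; ptgt = λ _ → refl ; pvty = λ _ → refl ; pety = λ _ → refl }

  inB-fullSub : (G : Graph S) (k : V G → Bool) (a b : V (fullSub G k)) →
                inB (fullSub G k) a b ≡ inB G (proj₁ a) (proj₁ b)
  inB-fullSub G k (a , pa) (b , pb) = T-ext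
    (λ t → case1 (inB⇒Edge (fullSub G k) _ _ t))
    (λ t → case2 (inB⇒Edge G a b t))
    where
      case1 : Edge (fullSub G k) (a , pa) (b , pb) → InBox G a b
      case1 ((e , _) , refl , refl) = Edge⇒inB G _ _ (e , refl , refl)
      case2 : Edge G a b → InBox (fullSub G k) (a , pa) (b , pb)
      case2 (e , refl , refl) = Edge⇒inB (fullSub G k) _ _ ((e , T-∧⁺ pa pb) , ΣT-≡ {p = k} refl , ΣT-≡ {p = k} refl)

  ≟-fullSub : (G : Graph S) (k : V G → Bool) (a b : V (fullSub G k)) →
              ⌊ _≟V_ (fullSub G k) a b ⌋ ≡ ⌊ _≟V_ G (proj₁ a) (proj₁ b) ⌋
  ≟-fullSub G k (a , pa) (b , pb) =
    T-ext (λ t → fromWitness {a? = _≟V_ G a b} (cong proj₁ (toWitness {a? = _≟V_ (fullSub G k) _ _} t)))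
          (λ t → fromWitness {a? = _≟V_ (fullSub G k) _ _} (ΣT-≡ {p = k} (toWitness {a? = _≟V_ G a b} t)))

isFirst : {A B : Set} → A ⊎ B → Bool
isFirst (inj₁ _) = true
isFirst (inj₂ _) = false

module _ {S : Sig} where
  open Graph

  outsideBox : (G : Graph S) (b : V G) → V G → Bool
  outsideBox G b v = not (inB G b v)

  otherThan : (G : Graph S) (b : V G) → V G → Bool
  otherThan G b v = not ⌊ _≟V_ G v b ⌋

  Box : (G : Graph S) → V G → Set
  Box G b = Σ (V G) (T ∘ inB G b)

  Copied : (G : Graph S) (b : V G) → E G → Bool
  Copied G b e = inB G b (src G e) ∨ inB G b (tgt G e)

  embD : (G : Graph S) (b v : V G) → Dec (InBox G b v) → V (COPY G b)
  embD G b v (yes q) = inj₂ (v , q)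
  embD G b v (no _) = inj₁ v

  embed : (G : Graph S) (b v : V G) → V (COPY G b)
  embed G b v = embD G b v (T? (inB G b v))

  src-copy : (G : Graph S) (b : V G) (e : E G) (p : T (Copied G b e)) → src (COPY G b) (inj₂ (e , p)) ≡ embed G b (src G e)
  src-copy G b e p with T? (inB G b (src G e))
  ... | yes q = refl
  ... | no n = refl

  tgt-copy : (G : Graph S) (b : V G) (e : E G) (p : T (Copied G b e)) → tgt (COPY G b) (inj₂ (e , p)) ≡ embed G b (tgt G e)
  tgt-copy G b e p with T? (inB G b (tgt G e))
  ... | yes q = refl
  ... | no n = refl

  embed-in : (G : Graph S) (b v : V G) (q : InBox G b v) → embed G b v ≡ inj₂ (v , q)
  embed-in G b v q with T? (inB G b v)
  ... | yes q' = cong inj₂ (ΣT-≡ {p = inB G b} refl)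
  ... | no n = ⊥-elim (n q)

  embed-out : (G : Graph S) (b v : V G) → ¬ InBox G b v → embed G b v ≡ inj₁ v
  embed-out G b v n with T? (inB G b v)
  ... | yes q = ⊥-elim (n q)
  ... | no _ = refl

  embed≡inj₁ : (G : Graph S) (b v x : V G) → embed G b v ≡ inj₁ x → (v ≡ x) × ¬ InBox G b v
  embed≡inj₁ G b v x eq with T? (inB G b v)
  ... | yes q = ⊥-elim (inj₁≢inj₂ (sym eq))
  ... | no n = inj₁-injective eq , n

  embed≡inj₂ : (G : Graph S) (b v : V G) (x : Box G b) → embed G b v ≡ inj₂ x → v ≡ proj₁ x
  embed≡inj₂ G b v x eq with T? (inB G b v)
  ... | yes q = cong proj₁ (inj₂-injective eq)
  ... | no n = ⊥-elim (inj₁≢inj₂ eq)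

  embed-vty : (G : Graph S) (b v : V G) → vty (COPY G b) (embed G b v) ≡ vty G v
  embed-vty G b v with T? (inB G b v)
  ... | yes q = refl
  ... | no n = refl

  expKeep : (G : Graph S) (c : V G) (p : InBox G c c) → V (COPY G c) → Bool
  expKeep G c p v = not ⌊ _≟V_ (COPY G c) v (inj₂ (c , p)) ⌋

  expKeep-first : (G : Graph S) (c b : V G) (p : InBox G c c) → T (expKeep G c p (inj₁ b))
  expKeep-first G c b p = T-not⁺ (λ t → inj₁≢inj₂ (toWitness {a? = _≟V_ (COPY G c) (inj₁ b) (inj₂ (c , p))} t))

  expKeep-second : (G : Graph S) (c b : V G) (p : InBox G c c) (q : InBox G c b) → b ≢ c →
                   T (expKeep G c p (inj₂ (b , q)))
  expKeep-second G c b p q ne =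
    T-not⁺ (λ t → ne (cong proj₁ (inj₂-injective (toWitness {a? = _≟V_ (COPY G c) _ _} t))))

  module _ (G : Graph S) (b : V G) where
    private
      C = COPY G b

    inB-copy₁₁ : (x y : V G) → inB C (inj₁ x) (inj₁ y) ≡ inB G x y
    inB-copy₁₁ x y = T-ext (λ t → h (inB⇒Edge C _ _ t)) (λ t → h' (inB⇒Edge G x y t))
      where
        h : Edge C (inj₁ x) (inj₁ y) → InBox G x y
        h (inj₁ e , refl , refl) = Edge⇒inB G _ _ (e , refl , refl)
        h (inj₂ (e , p) , s , t)
          with embed≡inj₁ G b _ _ (trans (sym (src-copy G b e p)) s) | embed≡inj₁ G b _ _ (trans (sym (tgt-copy G b e p)) t)
        ... | _ , n1 | _ , n2 with T-∨⁻ p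
        ... | inj₁ q = ⊥-elim (n1 q)
        ... | inj₂ q = ⊥-elim (n2 q)
        h' : Edge G x y → InBox C (inj₁ x) (inj₁ y)
        h' (e , refl , refl) = Edge⇒inB C _ _ (inj₁ e , refl , refl)

    inB-copy₂₂ : (x y : Box G b) → inB C (inj₂ x) (inj₂ y) ≡ inB G (proj₁ x) (proj₁ y)
    inB-copy₂₂ (x , qx) (y , qy) = T-ext (λ t → h (inB⇒Edge C _ _ t)) (λ t → h' (inB⇒Edge G x y t))
      where
        h : Edge C (inj₂ (x , qx)) (inj₂ (y , qy)) → InBox G x y
        h (inj₂ (e , p) , s , t) = Edge⇒inB G _ _ (e , embed≡inj₂ G b _ _ (trans (sym (src-copy G b e p)) s)
                                                     , embed≡inj₂ G b _ _ (trans (sym (tgt-copy G b e p)) t))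
        h' : Edge G x y → InBox C (inj₂ (x , qx)) (inj₂ (y , qy))
        h' (e , refl , refl) = Edge⇒inB C _ _ (inj₂ (e , T-∨⁺ˡ qx) , trans (src-copy G b e (T-∨⁺ˡ qx)) (embed-in G b _ qx)
                                                                  , trans (tgt-copy G b e (T-∨⁺ˡ qx)) (embed-in G b _ qy))

    inB-copy₁₂ : (x : V G) (y : Box G b) → InBox C (inj₁ x) (inj₂ y) →
                 InBox G x (proj₁ y) × ¬ InBox G b x
    inB-copy₁₂ x (y , qy) t with inB⇒Edge C _ _ t
    ... | inj₂ (e , p) , s , u with embed≡inj₁ G b _ _ (trans (sym (src-copy G b e p)) s)
    ... | refl , n = Edge⇒inB G _ _ (e , refl , embed≡inj₂ G b _ _ (trans (sym (tgt-copy G b e p)) u)) , n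

    inB-copy₁₂⁺ : (x : V G) (y : Box G b) → InBox G x (proj₁ y) → ¬ InBox G b x →
                  InBox C (inj₁ x) (inj₂ y)
    inB-copy₁₂⁺ x (y , qy) t n with inB⇒Edge G x y t
    ... | e , refl , refl = Edge⇒inB C _ _ (inj₂ (e , T-∨⁺ʳ qy) , trans (src-copy G b e (T-∨⁺ʳ qy)) (embed-out G b _ n)
                                                                , trans (tgt-copy G b e (T-∨⁺ʳ qy)) (embed-in G b _ qy))

    inB-copy₂₁ : (x : Box G b) (y : V G) → InBox C (inj₂ x) (inj₁ y) →
                 InBox G (proj₁ x) y × ¬ InBox G b y
    inB-copy₂₁ (x , qx) y t with inB⇒Edge C _ _ t
    ... | inj₂ (e , p) , s , u with embed≡inj₁ G b _ _ (trans (sym (tgt-copy G b e p)) u)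
    ... | refl , n = Edge⇒inB G _ _ (e , embed≡inj₂ G b _ _ (trans (sym (src-copy G b e p)) s) , refl) , n

    inB-copy₂₁⁺ : (x : Box G b) (y : V G) → InBox G (proj₁ x) y → ¬ InBox G b y →
                  InBox C (inj₂ x) (inj₁ y)
    inB-copy₂₁⁺ (x , qx) y t n with inB⇒Edge G x y t
    ... | e , refl , refl = Edge⇒inB C _ _ (inj₂ (e , T-∨⁺ˡ qx) , trans (src-copy G b e (T-∨⁺ˡ qx)) (embed-in G b _ qx)
                                                                , trans (tgt-copy G b e (T-∨⁺ˡ qx)) (embed-out G b _ n))

  ≟-copy₁₁ : (G : Graph S) (c v w : V G) → ⌊ _≟V_ (COPY G c) (inj₁ v) (inj₁ w) ⌋ ≡ ⌊ _≟V_ G v w ⌋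
  ≟-copy₁₁ G c v w =
    T-ext (λ t → fromWitness {a? = _≟V_ G v w} (inj₁-injective (toWitness {a? = _≟V_ (COPY G c) _ _} t)))
          (λ t → fromWitness {a? = _≟V_ (COPY G c) _ _} (cong inj₁ (toWitness {a? = _≟V_ G v w} t)))

  ≟-copy₂₂ : (G : Graph S) (c : V G) (v w : Box G c) →
             ⌊ _≟V_ (COPY G c) (inj₂ v) (inj₂ w) ⌋ ≡ ⌊ _≟V_ G (proj₁ v) (proj₁ w) ⌋
  ≟-copy₂₂ G c v w =
    T-ext (λ t → fromWitness {a? = _≟V_ G _ _} (cong proj₁ (inj₂-injective (toWitness {a? = _≟V_ (COPY G c) _ _} t))))
          (λ t → fromWitness {a? = _≟V_ (COPY G c) _ _} (cong inj₂ (ΣT-≡ {p = inB G c} (toWitness {a? = _≟V_ G _ _} t))))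

  ≟-copy₁₂ : (G : Graph S) (c v : V G) (w : Box G c) → ⌊ _≟V_ (COPY G c) (inj₁ v) (inj₂ w) ⌋ ≡ false
  ≟-copy₁₂ G c v w = ¬T⇒≡false (λ t → inj₁≢inj₂ (toWitness {a? = _≟V_ (COPY G c) (inj₁ v) (inj₂ w)} t))

  ≟-copy₂₁ : (G : Graph S) (c v : V G) (w : Box G c) → ⌊ _≟V_ (COPY G c) (inj₂ w) (inj₁ v) ⌋ ≡ false
  ≟-copy₂₁ G c v w = ¬T⇒≡false (λ t → inj₁≢inj₂ (sym (toWitness {a? = _≟V_ (COPY G c) (inj₂ w) (inj₁ v)} t)))

module _ {S : Sig} where
  open Graph

  origin : (G : Graph S) (b : V G) → V (COPY G b) → V G
  origin G b (inj₁ v) = v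
  origin G b (inj₂ (v , _)) = v

  originE : (G : Graph S) (b : V G) → E (COPY G b) → E G
  originE G b (inj₁ e) = e
  originE G b (inj₂ (e , _)) = e

  inB-copyOutside : (G : Graph S) (b a : V G) → ¬ InBox G b a →
                    ∀ x → inB (COPY G b) (inj₁ a) x ≡ inB G a (origin G b x)
  inB-copyOutside G b a na (inj₁ v) = inB-copy₁₁ G b a v
  inB-copyOutside G b a na (inj₂ (v , q)) =
    T-ext (λ t → proj₁ (inB-copy₁₂ G b a (v , q) t)) (λ t → inB-copy₁₂⁺ G b a (v , q) t na)

  inB-copyFirst : (G : Graph S) (b a : V G) → InBox G b a →
                  ∀ x → inB (COPY G b) (inj₁ a) x ≡ isFirst x ∧ inB G a (origin G b x)
  inB-copyFirst G b a ya (inj₁ v) = inB-copy₁₁ G b a v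
  inB-copyFirst G b a ya (inj₂ (v , q)) = T-ext (λ t → proj₂ (inB-copy₁₂ G b a (v , q) t) ya) (λ ())

  origin-embed : (G : Graph S) (b v : V G) → origin G b (embed G b v) ≡ v
  origin-embed G b v with T? (inB G b v)
  ... | yes q = refl
  ... | no n = refl

  origin-src : (G : Graph S) (b : V G) (e : E (COPY G b)) →
               origin G b (src (COPY G b) e) ≡ src G (originE G b e)
  origin-src G b (inj₁ e) = refl
  origin-src G b (inj₂ (e , p)) = trans (cong (origin G b) (src-copy G b e p)) (origin-embed G b _)

  origin-tgt : (G : Graph S) (b : V G) (e : E (COPY G b)) →
               origin G b (tgt (COPY G b) e) ≡ tgt G (originE G b e)
  origin-tgt G b (inj₁ e) = refl
  origin-tgt G b (inj₂ (e , p)) = trans (cong (origin G b) (tgt-copy G b e p)) (origin-embed G b _)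

  copyBoxEdges : (G : Graph S) (b a : V G) → ¬ InBox G b a → (e : E (COPY G b)) →
                 Copied (COPY G b) (inj₁ a) e ≡ Copied G a (originE G b e)
  copyBoxEdges G b a na e = cong₂ _∨_ (trans (inB-copyOutside G b a na _) (cong (inB G a) (origin-src G b e)))
                             (trans (inB-copyOutside G b a na _) (cong (inB G a) (origin-tgt G b e)))

  liftKeep : (G : Graph S) (b : V G) (k : V G → Bool) → V (COPY G b) → Bool
  liftKeep G b k (inj₁ v) = k v
  liftKeep G b k (inj₂ (v , _)) = k v

  liftKeep-embed : (G : Graph S) (b : V G) (k : V G → Bool) (v : V G) → liftKeep G b k (embed G b v) ≡ k v
  liftKeep-embed G b k v with T? (inB G b v)
  ... | yes q = refl
  ... | no n = refl

  liftKeep-origin : (G : Graph S) (c : V G) (k : V G → Bool) (x : V (COPY G c)) → liftKeep G c k x ≡ k (origin G c x)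
  liftKeep-origin G c k (inj₁ v) = refl
  liftKeep-origin G c k (inj₂ (v , q)) = refl

module _ {S : Sig} where
  open Graph

  module _ {G H : Graph S} (I : Iso′ G H) (b : V G) where
    private
      b' : V H
      b' = fv I b
      CG CH : Graph S
      CG = COPY G b
      CH = COPY H b'
      qf : ∀ v → InBox G b v → InBox H b' (fv I v)
      qf v q = subst T (sym (iso-inB I b v)) q
      qg : ∀ w → InBox H b' w → InBox G b (gv I w)
      qg w q = subst T (trans (cong (inB H b') (sym (fvgv I w))) (iso-inB I b (gv I w))) q
      keG : E G → Bool
      keG = Copied G b
      keH : E H → Bool
      keH = Copied H b'
      keq : ∀ e → keH (fe I e) ≡ keG e
      keq e = cong₂ _∨_ (trans (cong (inB H b') (psrc I e)) (iso-inB I b _))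
                        (trans (cong (inB H b') (ptgt I e)) (iso-inB I b _))

    cfv : V CG → V CH
    cfv (inj₁ v) = inj₁ (fv I v)
    cfv (inj₂ (v , q)) = inj₂ (fv I v , qf v q)

    cgv : V CH → V CG
    cgv (inj₁ w) = inj₁ (gv I w)
    cgv (inj₂ (w , q)) = inj₂ (gv I w , qg w q)

    cfe : E CG → E CH
    cfe (inj₁ e) = inj₁ (fe I e)
    cfe (inj₂ (e , p)) = inj₂ (fe I e , subst T (sym (keq e)) p)

    cge : E CH → E CG
    cge (inj₁ e) = inj₁ (ge I e)
    cge (inj₂ (e , p)) = inj₂ (ge I e , subst T (keq (ge I e)) (subst T (cong keH (sym (fege I e))) p))

    embNat : ∀ v → embed H b' (fv I v) ≡ cfv (embed G b v)
    embNat v with T? (inB G b v)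
    ... | yes q = embed-in H b' _ (qf v q)
    ... | no n = embed-out H b' _ (λ q → n (subst T (iso-inB I b v) q))

    COPY-cong : Iso′ CG CH
    COPY-cong = record
      { fv = cfv ; gv = cgv
      ; fvgv = λ { (inj₁ w) → cong inj₁ (fvgv I w) ; (inj₂ (w , q)) → cong inj₂ (ΣT-≡ {p = inB H b'} (fvgv I w)) }
      ; gvfv = λ { (inj₁ v) → cong inj₁ (gvfv I v) ; (inj₂ (v , q)) → cong inj₂ (ΣT-≡ {p = inB G b} (gvfv I v)) }
      ; fe = cfe ; ge = cge
      ; fege = λ { (inj₁ e) → cong inj₁ (fege I e) ; (inj₂ (e , p)) → cong inj₂ (ΣT-≡ {p = keH} (fege I e)) }
      ; gefe = λ { (inj₁ e) → cong inj₁ (gefe I e) ; (inj₂ (e , p)) → cong inj₂ (ΣT-≡ {p = keG} (gefe I e)) }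
      ; psrc = λ { (inj₁ e) → cong inj₁ (psrc I e)
                 ; (inj₂ (e , p)) → trans (src-copy H b' (fe I e) (subst T (sym (keq e)) p))
                                          (trans (cong (embed H b') (psrc I e))
                                                 (trans (embNat (src G e)) (cong cfv (sym (src-copy G b e p))))) }
      ; ptgt = λ { (inj₁ e) → cong inj₁ (ptgt I e)
                 ; (inj₂ (e , p)) → trans (tgt-copy H b' (fe I e) (subst T (sym (keq e)) p))
                                          (trans (cong (embed H b') (ptgt I e))
                                                 (trans (embNat (tgt G e)) (cong cfv (sym (tgt-copy G b e p))))) }
      ; pvty = λ { (inj₁ v) → pvty I v ; (inj₂ (v , q)) → pvty I v }
      ; pety = λ { (inj₁ e) → pety I e ; (inj₂ (e , p)) → pety I e } }

    COPY-cong-second : (p : InBox G b b) (p' : InBox H b' b') → fv COPY-cong (inj₂ (b , p)) ≡ inj₂ (b' , p')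
    COPY-cong-second p p' = cong inj₂ (ΣT-≡ {p = inB H b'} refl)

  KILL-cong : {G H : Graph S} (I : Iso′ G H) (b : V G) → Iso′ (KILL G b) (KILL H (fv I b))
  KILL-cong I b = fullSub-cong I _ _ (λ v → cong not (iso-inB I b v))

  EXP-cong : {G H : Graph S} (I : Iso′ G H) (b : V G) (p : InBox G b b) (p' : InBox H (fv I b) (fv I b)) →
           Iso′ (EXP G b p) (EXP H (fv I b) p')
  EXP-cong {G} {H} I b p p' = fullSub-cong (COPY-cong I b) _ _
    (λ v → cong not (trans (cong (λ z → ⌊ _≟V_ (COPY H (fv I b)) (fv (COPY-cong I b) v) z ⌋)
                                  (sym (COPY-cong-second I b p p')))
                           (iso-≟ (COPY-cong I b) v (inj₂ (b , p)))))

module _ {S : Sig} where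
  open Graph

  module _ (G : Graph S) (k : V G → Bool) (b : V G) (pb : T (k b)) where
    private
      F : Graph S
      F = fullSub G k
      bF : V F
      bF = b , pb
      L CG : Graph S
      L = COPY F bF
      CG = COPY G b
      lk : V CG → Bool
      lk = liftKeep G b k
      R : Graph S
      R = fullSub CG lk
      inBF : ∀ v p → inB F bF (v , p) ≡ inB G b v
      inBF v p = inB-fullSub G k bF (v , p)
      keG : E G → Bool
      keG = Copied G b
      keF : E F → Bool
      keF = Copied F bF
      keq : ∀ e p → keF (e , p) ≡ keG e
      keq e p = cong₂ _∨_ (inBF _ _) (inBF _ _)
      keptE : E CG → Bool
      keptE e = lk (src CG e) ∧ lk (tgt CG e)
      kk2 : ∀ e q → keptE (inj₂ (e , q)) ≡ k (src G e) ∧ k (tgt G e)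
      kk2 e q = cong₂ _∧_ (trans (cong lk (src-copy G b e q)) (liftKeep-embed G b k _))
                          (trans (cong lk (tgt-copy G b e q)) (liftKeep-embed G b k _))

    cfF : V L → V R
    cfF (inj₁ (v , p)) = inj₁ v , p
    cfF (inj₂ ((v , p) , q)) = inj₂ (v , subst T (inBF v p) q) , p

    cgF : V R → V L
    cgF (inj₁ v , p) = inj₁ (v , p)
    cgF (inj₂ (v , q) , p) = inj₂ ((v , p) , subst T (sym (inBF v p)) q)

    ceF : E L → E R
    ceF (inj₁ (e , p)) = inj₁ e , p
    ceF (inj₂ ((e , p) , q)) = inj₂ (e , subst T (keq e p) q) , subst T (sym (kk2 e (subst T (keq e p) q))) p

    cgeF : E R → E L
    cgeF (inj₁ e , p) = inj₁ (e , p)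
    cgeF (inj₂ (e , q) , p) = inj₂ ((e , subst T (kk2 e q) p) , subst T (sym (keq e (subst T (kk2 e q) p))) q)

    embF : ∀ v p → proj₁ (cfF (embed F bF (v , p))) ≡ embed G b v
    embF v p with T? (inB F bF (v , p))
    ... | yes q = sym (embed-in G b v _)
    ... | no n = sym (embed-out G b v (λ q → n (subst T (sym (inBF v p)) q)))

    COPY-fullSub : Iso′ L R
    COPY-fullSub = record
      { fv = cfF ; gv = cgF
      ; fvgv = λ { (inj₁ v , p) → refl
                 ; (inj₂ (v , q) , p) → ΣT-≡ {p = lk} (cong inj₂ (ΣT-≡ {p = inB G b} refl)) }
      ; gvfv = λ { (inj₁ (v , p)) → refl ; (inj₂ ((v , p) , q)) → cong inj₂ (ΣT-≡ {p = inB F bF} refl) }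
      ; fe = ceF ; ge = cgeF
      ; fege = λ { (inj₁ e , p) → refl
                 ; (inj₂ (e , q) , p) → ΣT-≡ {p = keptE} (cong inj₂ (ΣT-≡ {p = keG} refl)) }
      ; gefe = λ { (inj₁ (e , p)) → refl
                 ; (inj₂ ((e , p) , q)) → cong inj₂ (ΣT-≡ {p = keF} (ΣT-≡ {p = λ e → k (src G e) ∧ k (tgt G e)} refl)) }
      ; psrc = λ { (inj₁ (e , p)) → refl
                 ; (inj₂ ((e , p) , q)) → ΣT-≡ {p = lk} (trans (src-copy G b e (subst T (keq e p) q))
                     (trans (sym (embF (src G e) _)) (cong (proj₁ ∘ cfF) (sym (src-copy F bF (e , p) q))))) }
      ; ptgt = λ { (inj₁ (e , p)) → refl
                 ; (inj₂ ((e , p) , q)) → ΣT-≡ {p = lk} (trans (tgt-copy G b e (subst T (keq e p) q))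
                     (trans (sym (embF (tgt G e) _)) (cong (proj₁ ∘ cfF) (sym (tgt-copy F bF (e , p) q))))) }
      ; pvty = λ { (inj₁ _) → refl ; (inj₂ _) → refl }
      ; pety = λ { (inj₁ _) → refl ; (inj₂ _) → refl } }

  module _ (G : Graph S) (b : V G) (k : V (COPY G b) → Bool) (k0 : V G → Bool)
           (h1 : ∀ v → k (inj₁ v) ≡ k0 v) (h2 : ∀ x → k (inj₂ x) ≡ false) where
    private
      C R : Graph S
      C = COPY G b
      R = fullSub C k
      kE : E C → Bool
      kE e = k (src C e) ∧ k (tgt C e)
      k0E : E G → Bool
      k0E e = k0 (src G e) ∧ k0 (tgt G e)
      noC2 : ∀ e q → ¬ T (kE (inj₂ (e , q)))
      noC2 e q p with T-∨⁻ q
      ... | inj₁ r = subst T (trans (cong k (trans (src-copy G b e q) (embed-in G b _ r))) (h2 _)) (∧-l _ _ p)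
      ... | inj₂ r = subst T (trans (cong k (trans (tgt-copy G b e q) (embed-in G b _ r))) (h2 _)) (∧-r _ _ p)
      fv1 : V R → V (fullSub G k0)
      fv1 (inj₁ v , p) = v , subst T (h1 v) p
      fv1 (inj₂ x , p) = ⊥-elim (subst T (h2 x) p)
      fe1 : E R → E (fullSub G k0)
      fe1 (inj₁ e , p) = e , T-∧⁺ (subst T (h1 _) (∧-l _ _ p)) (subst T (h1 _) (∧-r _ _ p))
      fe1 (inj₂ (e , q) , p) = ⊥-elim (noC2 e q p)

    fullSub-firstCopies : Iso′ R (fullSub G k0)
    fullSub-firstCopies = record
      { fv = fv1
      ; gv = λ { (v , p) → inj₁ v , subst T (sym (h1 v)) p }
      ; fvgv = λ { (v , p) → ΣT-≡ {p = k0} refl }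
      ; gvfv = λ { (inj₁ v , p) → ΣT-≡ {p = k} refl ; (inj₂ x , p) → ⊥-elim (subst T (h2 x) p) }
      ; fe = fe1
      ; ge = λ { (e , p) → inj₁ e , T-∧⁺ (subst T (sym (h1 _)) (∧-l _ _ p)) (subst T (sym (h1 _)) (∧-r _ _ p)) }
      ; fege = λ { (e , p) → ΣT-≡ {p = k0E} refl }
      ; gefe = λ { (inj₁ e , p) → ΣT-≡ {p = kE} refl ; (inj₂ (e , q) , p) → ⊥-elim (noC2 e q p) }
      ; psrc = λ { (inj₁ e , p) → ΣT-≡ {p = k0} refl ; (inj₂ (e , q) , p) → ⊥-elim (noC2 e q p) }
      ; ptgt = λ { (inj₁ e , p) → ΣT-≡ {p = k0} refl ; (inj₂ (e , q) , p) → ⊥-elim (noC2 e q p) }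
      ; pvty = λ { (inj₁ v , p) → refl ; (inj₂ x , p) → ⊥-elim (subst T (h2 x) p) }
      ; pety = λ { (inj₁ e , p) → refl ; (inj₂ (e , q) , p) → ⊥-elim (noC2 e q p) } }

  module _ (G : Graph S) (b : V G) (k : V (COPY G b) → Bool) (k0 : V G → Bool)
           (h1 : ∀ v → ¬ InBox G b v → k (inj₁ v) ≡ k0 v) (h1' : ∀ v → InBox G b v → k (inj₁ v) ≡ false)
           (h2 : ∀ x → k (inj₂ x) ≡ k0 (proj₁ x)) where
    private
      C R : Graph S
      C = COPY G b
      R = fullSub C k
      kE : E C → Bool
      kE e = k (src C e) ∧ k (tgt C e)
      k0E : E G → Bool
      k0E e = k0 (src G e) ∧ k0 (tgt G e)
      keG : E G → Bool
      keG = Copied G b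
      kp : ∀ v → T (k (inj₁ v)) → T (k0 v)
      kp v p with T? (inB G b v)
      ... | yes q = ⊥-elim (subst T (h1' v q) p)
      ... | no n = subst T (h1 v n) p
      nb : ∀ v → T (k (inj₁ v)) → ¬ InBox G b v
      nb v p q = subst T (h1' v q) p
      kEmb : ∀ v → T (k0 v) → T (k (embed G b v))
      kEmb v p with T? (inB G b v)
      ... | yes q = subst T (sym (h2 _)) p
      ... | no n = subst T (sym (h1 v n)) p
      kEmb⁻ : ∀ v → T (k (embed G b v)) → T (k0 v)
      kEmb⁻ v p with T? (inB G b v)
      ... | yes q = subst T (h2 _) p
      ... | no n = subst T (h1 v n) p
      fv0 : V R → V (fullSub G k0)
      fv0 (inj₁ v , p) = v , kp v p
      fv0 (inj₂ (v , q) , p) = v , subst T (h2 _) p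
      gv0 : V (fullSub G k0) → V R
      gv0 (v , p) = embed G b v , kEmb v p
      fvEmb : ∀ v r → proj₁ (fv0 (embed G b v , r)) ≡ v
      fvEmb v r with T? (inB G b v)
      ... | yes q = refl
      ... | no n = refl
      fvAt : ∀ (x : V C) r v → x ≡ embed G b v → proj₁ (fv0 (x , r)) ≡ v
      fvAt .(embed G b v) r v refl = fvEmb v r
      kSrc2 : ∀ e q → T (k (src C (inj₂ (e , q)))) → T (k0 (src G e))
      kSrc2 e q p = kEmb⁻ _ (subst T (cong k (src-copy G b e q)) p)
      kTgt2 : ∀ e q → T (k (tgt C (inj₂ (e , q)))) → T (k0 (tgt G e))
      kTgt2 e q p = kEmb⁻ _ (subst T (cong k (tgt-copy G b e q)) p)
      fe0 : E R → E (fullSub G k0)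
      fe0 (inj₁ e , p) = e , T-∧⁺ (kp _ (∧-l _ _ p)) (kp _ (∧-r _ _ p))
      fe0 (inj₂ (e , q) , p) = e , T-∧⁺ (kSrc2 e q (∧-l _ _ p)) (kTgt2 e q (∧-r _ _ p))
      geD : ∀ e → T (k0E e) → Dec (T (keG e)) → E R
      geD e p (yes q) = inj₂ (e , q) , T-∧⁺ (subst T (cong k (sym (src-copy G b e q))) (kEmb _ (∧-l _ _ p)))
                                          (subst T (cong k (sym (tgt-copy G b e q))) (kEmb _ (∧-r _ _ p)))
      geD e p (no n) = inj₁ e , T-∧⁺ (subst T (sym (h1 _ (λ r → n (T-∨⁺ˡ r)))) (∧-l _ _ p))
                                   (subst T (sym (h1 _ (λ r → n (T-∨⁺ʳ r)))) (∧-r _ _ p))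
      ge0 : E (fullSub G k0) → E R
      ge0 (e , p) = geD e p (T? (keG e))
      fegeD : ∀ e p d → fe0 (geD e p d) ≡ (e , p)
      fegeD e p (yes q) = ΣT-≡ {p = k0E} refl
      fegeD e p (no n) = ΣT-≡ {p = k0E} refl
      gefe0 : ∀ x → ge0 (fe0 x) ≡ x
      gefe0 (inj₁ e , p) with T? (keG e)
      ... | yes q with T-∨⁻ q
      ...   | inj₁ r = ⊥-elim (nb _ (∧-l _ _ p) r)
      ...   | inj₂ r = ⊥-elim (nb _ (∧-r _ _ p) r)
      gefe0 (inj₁ e , p) | no n = ΣT-≡ {p = kE} refl
      gefe0 (inj₂ (e , q) , p) with T? (keG e)
      ... | yes q' = ΣT-≡ {p = kE} (cong inj₂ (ΣT-≡ {p = keG} refl))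
      ... | no n = ⊥-elim (n q)
      fvgv0 : ∀ y → fv0 (gv0 y) ≡ y
      fvgv0 (v , p) = ΣT-≡ {p = k0} (fvEmb v (kEmb v p))
      gvfv0 : ∀ x → gv0 (fv0 x) ≡ x
      gvfv0 (inj₁ v , p) = ΣT-≡ {p = k} (embed-out G b v (nb v p))
      gvfv0 (inj₂ (v , q) , p) = ΣT-≡ {p = k} (trans (embed-in G b v q) refl)

    fullSub-embedded : Iso′ R (fullSub G k0)
    fullSub-embedded = record
      { fv = fv0 ; gv = gv0 ; fvgv = fvgv0 ; gvfv = gvfv0
      ; fe = fe0 ; ge = ge0 ; fege = λ { (e , p) → fegeD e p (T? (keG e)) } ; gefe = gefe0
      ; psrc = λ { (inj₁ e , p) → ΣT-≡ {p = k0} refl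
                 ; (inj₂ (e , q) , p) → ΣT-≡ {p = k0} (sym (fvAt _ (∧-l _ _ p) (src G e) (src-copy G b e q))) }
      ; ptgt = λ { (inj₁ e , p) → ΣT-≡ {p = k0} refl
                 ; (inj₂ (e , q) , p) → ΣT-≡ {p = k0} (sym (fvAt _ (∧-r _ _ p) (tgt G e) (tgt-copy G b e q))) }
      ; pvty = λ { (inj₁ v , p) → refl ; (inj₂ (v , q) , p) → refl }
      ; pety = λ { (inj₁ e , p) → refl ; (inj₂ (e , q) , p) → refl } }

module _ {S : Sig} where
  open Graph

  fullSub-fullSub∧ : (G : Graph S) (k1 : V G → Bool) (k2 : V (fullSub G k1) → Bool) (f : V G → Bool) →
          (∀ v p → k2 (v , p) ≡ f v) → Iso′ (fullSub (fullSub G k1) k2) (fullSub G (λ v → k1 v ∧ f v))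
  fullSub-fullSub∧ G k1 k2 f eq =
    fullSub-fullSub G k1 k2 _ (λ v t → ∧-l _ _ t) (λ v p → trans (eq v p) (sym (∧-T⇒ (f v) p)))

  KILL-fullSub : (G : Graph S) (k1 : V G → Bool) (c : V G) (pc : T (k1 c)) →
       Iso′ (KILL (fullSub G k1) (c , pc)) (fullSub G (λ v → k1 v ∧ outsideBox G c v))
  KILL-fullSub G k1 c pc = fullSub-fullSub∧ G k1 _ (outsideBox G c) (λ v p → cong not (inB-fullSub G k1 (c , pc) (v , p)))

  DROP-fullSub : (G : Graph S) (k1 : V G → Bool) (c : V G) (pc : T (k1 c)) →
       Iso′ (DROP (fullSub G k1) (c , pc)) (fullSub G (λ v → k1 v ∧ otherThan G c v))
  DROP-fullSub G k1 c pc = fullSub-fullSub∧ G k1 _ (otherThan G c) (λ v p → cong not (≟-fullSub G k1 (v , p) (c , pc)))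

  EXP-fullSub : (G : Graph S) (k1 : V G → Bool) (c : V G) (pc : T (k1 c))
                (p : InBox (fullSub G k1) (c , pc) (c , pc)) (p0 : InBox G c c) →
       Iso′ (EXP (fullSub G k1) (c , pc) p) (fullSub (COPY G c) (λ x → liftKeep G c k1 x ∧ expKeep G c p0 x))
  EXP-fullSub G k1 c pc p p0 =
    isoTrans (fullSub-cong I _ k' pw) (fullSub-fullSub∧ (COPY G c) (liftKeep G c k1) k' (expKeep G c p0) (λ _ _ → refl))
    where
      F R : Graph S
      F = fullSub G k1
      R = fullSub (COPY G c) (liftKeep G c k1)
      I : Iso′ (COPY F (c , pc)) R
      I = COPY-fullSub G k1 c pc
      k' : V R → Bool
      k' x = expKeep G c p0 (proj₁ x)
      w≡ : inj₂ (c , p0) ≡ proj₁ (fv I (inj₂ ((c , pc) , p)))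
      w≡ = cong inj₂ (ΣT-≡ {p = inB G c} refl)
      pw : ∀ v → k' (fv I v) ≡ expKeep F (c , pc) p v
      pw v = cong not (trans (cong (λ z → ⌊ _≟V_ (COPY G c) (proj₁ (fv I v)) z ⌋) w≡)
                      (trans (sym (≟-fullSub (COPY G c) (liftKeep G c k1) (fv I v) (fv I (inj₂ ((c , pc) , p)))))
                             (iso-≟ I v (inj₂ ((c , pc) , p)))))

sublist-length : {A : Set} (k : A → Bool) (xs : List A) → length (sublist k xs) ≤ length xs
sublist-length k [] = z≤n
sublist-length k (x ∷ xs) with T? (k x)
... | yes _ = s≤s (sublist-length k xs)
... | no _ = m≤n⇒m≤1+n (sublist-length k xs)

sublist-length-< : {A : Set} (k : A → Bool) (xs : List A) (x : A) → x ∈ xs → ¬ T (k x) →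
                   length (sublist k xs) < length xs
sublist-length-< k (y ∷ xs) x (here refl) n with T? (k y)
... | yes p = ⊥-elim (n p)
... | no _ = s≤s (sublist-length k xs)
sublist-length-< k (y ∷ xs) x (there m) n with T? (k y)
... | yes _ = s≤s (sublist-length-< k xs x m n)
... | no _ = m≤n⇒m≤1+n (sublist-length-< k xs x m n)

module _ {S : Sig} where
  open Graph

  -- The three properties of box membership among !-vertices that the argument
  -- uses: every box contains its owner, boxes are nested along membership, and
  -- mutual membership forces equality.  They hold in every !-graph and are
  -- preserved by full subgraphs and by COPY.
  record BoxLaws (G : Graph S) : Set where
    field
      loop : ∀ b → Bang G b → InBox G b b
      nest : ∀ b c v → Bang G b → Bang G c → InBox G b c → InBox G c v → InBox G b v
      anti : ∀ a b → Bang G a → Bang G b → InBox G a b → InBox G b a → a ≡ b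
  open BoxLaws public

  bangGraph-boxLaws : (G : Graph S) → IsBangGraph G → BoxLaws G
  bangGraph-boxLaws G (_ , (lp , _ , _ , an) , _ , ns) = record
    { loop = λ b bb → Edge⇒inB G b b (lp b bb)
    ; nest = λ b c v bb bc x y → Edge⇒inB G b v (ns b c bb bc (inB⇒Edge G b c x) v (inB⇒Edge G c v y))
    ; anti = λ a b ba bb x y → an a b ba bb (inB⇒Edge G a b x) (inB⇒Edge G b a y) }

  boxLaws-fullSub : (G : Graph S) (k : V G → Bool) → BoxLaws G → BoxLaws (fullSub G k)
  boxLaws-fullSub G k I = record
    { loop = λ { (b , p) bb → subst T (sym (inB-fullSub G k _ _)) (loop I b bb) }
    ; nest = λ { (b , _) (c , _) (v , _) bb bc x y → subst T (sym (inB-fullSub G k _ _))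
                   (nest I b c v bb bc (subst T (inB-fullSub G k _ _) x) (subst T (inB-fullSub G k _ _) y)) }
    ; anti = λ { (a , _) (b , _) ba bb x y →
                   ΣT-≡ {p = k} (anti I a b ba bb (subst T (inB-fullSub G k _ _) x) (subst T (inB-fullSub G k _ _) y)) } }

  -- The box laws survive COPY_b: case analysis on the copies of the three
  -- vertices involved, using nesting in G to exclude the mixed cases.
  module _ (G : Graph S) (b : V G) (bb : Bang G b) (I : BoxLaws G) where
    private
      C : Graph S
      C = COPY G b
      Sb : Set
      Sb = Σ (V G) (T ∘ inB G b)
      to11 : ∀ x y → InBox C (inj₁ x) (inj₁ y) → InBox G x y
      to11 x y t = subst T (inB-copy₁₁ G b x y) t
      fr11 : ∀ x y → InBox G x y → InBox C (inj₁ x) (inj₁ y)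
      fr11 x y t = subst T (sym (inB-copy₁₁ G b x y)) t
      to22 : ∀ (x y : Sb) → InBox C (inj₂ x) (inj₂ y) → InBox G (proj₁ x) (proj₁ y)
      to22 x y t = subst T (inB-copy₂₂ G b x y) t
      fr22 : ∀ (x y : Sb) → InBox G (proj₁ x) (proj₁ y) → InBox C (inj₂ x) (inj₂ y)
      fr22 x y t = subst T (sym (inB-copy₂₂ G b x y)) t
      nestC : ∀ x y z → Bang C x → Bang C y → InBox C x y → InBox C y z → InBox C x z
      nestC (inj₁ x) (inj₁ y) (inj₁ z) bx by t u = fr11 x z (nest I x y z bx by (to11 x y t) (to11 y z u))
      nestC (inj₁ x) (inj₁ y) (inj₂ z) bx by t u with inB-copy₁₂ G b y z u
      ... | yz , ny = inB-copy₁₂⁺ G b x z (nest I x y _ bx by (to11 x y t) yz)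
                                     (λ bx' → ny (nest I b x y bb bx bx' (to11 x y t)))
      nestC (inj₁ x) (inj₂ y) (inj₁ z) bx by t u with inB-copy₁₂ G b x y t | inB-copy₂₁ G b y z u
      ... | xy , nx | yz , nz = fr11 x z (nest I x _ z bx by xy yz)
      nestC (inj₁ x) (inj₂ y) (inj₂ z) bx by t u with inB-copy₁₂ G b x y t
      ... | xy , nx = inB-copy₁₂⁺ G b x z (nest I x _ _ bx by xy (to22 y z u)) nx
      nestC (inj₂ x) (inj₁ y) z bx by t u with inB-copy₂₁ G b x y t
      ... | xy , ny = ⊥-elim (ny (nest I b _ y bb bx (proj₂ x) xy))
      nestC (inj₂ x) (inj₂ y) (inj₁ z) bx by t u with inB-copy₂₁ G b y z u
      ... | yz , nz = inB-copy₂₁⁺ G b x z (nest I _ _ z bx by (to22 x y t) yz) nz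
      nestC (inj₂ x) (inj₂ y) (inj₂ z) bx by t u = fr22 x z (nest I _ _ _ bx by (to22 x y t) (to22 y z u))
      antiC : ∀ x y → Bang C x → Bang C y → InBox C x y → InBox C y x → x ≡ y
      antiC (inj₁ x) (inj₁ y) bx by t u = cong inj₁ (anti I x y bx by (to11 x y t) (to11 y x u))
      antiC (inj₁ x) (inj₂ (y , qy)) bx by t u with inB-copy₁₂ G b x (y , qy) t | inB-copy₂₁ G b (y , qy) x u
      ... | xy , nx | yx , _ with anti I x y bx by xy yx
      ... | refl = ⊥-elim (nx qy)
      antiC (inj₂ (x , qx)) (inj₁ y) bx by t u with inB-copy₂₁ G b (x , qx) y t | inB-copy₁₂ G b y (x , qx) u
      ... | xy , ny | yx , _ with anti I x y bx by xy yx
      ... | refl = ⊥-elim (ny qx)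
      antiC (inj₂ (x , qx)) (inj₂ (y , qy)) bx by t u =
        cong inj₂ (ΣT-≡ {p = inB G b} (anti I x y bx by (to22 _ _ t) (to22 _ _ u)))
      loopC : ∀ x → Bang C x → InBox C x x
      loopC (inj₁ x) bx = fr11 x x (loop I x bx)
      loopC (inj₂ x) bx = fr22 x x (loop I _ bx)

    boxLaws-COPY : BoxLaws C
    boxLaws-COPY = record { loop = loopC ; nest = nestC ; anti = antiC }

  boxLaws-EXP : (G : Graph S) (c : V G) → Bang G c → BoxLaws G → (p : InBox G c c) → BoxLaws (EXP G c p)
  boxLaws-EXP G c bc I p = boxLaws-fullSub (COPY G c) (expKeep G c p) (boxLaws-COPY G c bc I)

  inB-copySecond : (G : Graph S) → BoxLaws G → (b a : V G) → Bang G b → Bang G a → (ya : InBox G b a) →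
                   ∀ x → inB (COPY G b) (inj₂ (a , ya)) x ≡ not (isFirst x) ∧ inB G a (origin G b x)
  inB-copySecond G I b a bb ba ya (inj₁ v) =
    T-ext (λ t → proj₂ (inB-copy₂₁ G b (a , ya) v t) (nest I b a v bb ba ya (proj₁ (inB-copy₂₁ G b (a , ya) v t))))
          (λ ())
  inB-copySecond G I b a bb ba ya (inj₂ (v , q)) = inB-copy₂₂ G b (a , ya) (v , q)

  depth0⁺ : (G : Graph S) (b : V G) → (∀ a → InBox G a b → a ≡ b) → Depth0 G b
  depth0⁺ G b h e t = h (src G e) (Edge⇒inB G _ _ (e , refl , t))

  depth0⁻ : (G : Graph S) (b : V G) → Depth0 G b → ∀ a → InBox G a b → a ≡ b
  depth0⁻ G b d a t with inB⇒Edge G a b t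
  ... | e , refl , t' = d e t'

  StrictPred : (G : Graph S) (b : V G) → Set
  StrictPred G b = Σ (V G) λ a → a ≢ b × InBox G a b

  -- since G is finite, b either has a strict predecessor or has depth 0
  strictPred? : (G : Graph S) (b : V G) → StrictPred G b ⊎ (∀ a → InBox G a b → a ≡ b)
  strictPred? G b with any? (λ a → ¬? (_≟V_ G a b) ×-dec T? (inB G a b)) (vlist G)
  ... | yes w = inj₁ (Any.satisfied w)
  ... | no nw = inj₂ depth0
    where
      depth0 : ∀ a → InBox G a b → a ≡ b
      depth0 a t with _≟V_ G a b
      ... | yes eq = eq
      ... | no n = ⊥-elim (nw (Any.map (λ { refl → n , t }) (vall G a)))

  -- The termination measure for pushing an operation on b through an
  -- instantiation: a list of length at most n containing every strict
  -- predecessor of b.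
  Covers : (G : Graph S) (b : V G) → List (V G) → Set
  Covers G b xs = ∀ a → a ≢ b → InBox G a b → a ∈ xs

  record PredBound (G : Graph S) (b : V G) (n : ℕ) : Set where
    constructor predBound
    field
      preds : List (V G)
      preds-length : length preds ≤ n
      preds-cover : Covers G b preds

  predBound-all : (G : Graph S) (b : V G) → PredBound G b (length (vlist G))
  predBound-all G b = predBound (vlist G) ≤-refl (λ a _ _ → vall G a)

  predBound-zero : {G : Graph S} {b a : V G} → PredBound G b zero → a ≢ b → InBox G a b → ⊥
  predBound-zero (predBound (_ ∷ _) () _) _ _
  predBound-zero (predBound [] _ cover) ne t with cover _ ne t
  ... | ()

  covers-fullSub : (G : Graph S) (k : V G → Bool) (b : V G) (pb : T (k b)) (xs : List (V G)) →
                   Covers G b xs → Covers (fullSub G k) (b , pb) (sublist k xs)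
  covers-fullSub G k b pb xs cover (a , pa) n t =
    sublist-complete k xs a pa (cover a (λ eq → n (ΣT-≡ {p = k} eq)) (subst T (inB-fullSub G k _ _) t))

  predBound-fullSub : (G : Graph S) (k : V G → Bool) (b : V G) (pb : T (k b)) {n : ℕ} →
                      PredBound G b n → PredBound (fullSub G k) (b , pb) n
  predBound-fullSub G k b pb (predBound xs lx cover) =
    predBound (sublist k xs) (≤-trans (sublist-length k xs) lx) (covers-fullSub G k b pb xs cover)

  predBound-copyFirst : (G : Graph S) → BoxLaws G → (c b : V G) → Bang G c → Bang G b → {n : ℕ} →
                        PredBound G b n → PredBound (COPY G c) (inj₁ b) n
  predBound-copyFirst G I c b bc bb (predBound xs lx cover) =
    predBound (map inj₁ xs) (≤-trans (≤-reflexive (length-map inj₁ xs)) lx) cover₁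
    where
      cover₁ : Covers (COPY G c) (inj₁ b) (map inj₁ xs)
      cover₁ (inj₁ a) n t = ∈-map⁺ inj₁ (cover a (λ eq → n (cong inj₁ eq)) (subst T (inB-copy₁₁ G c a b) t))
      cover₁ (inj₂ (a , qa)) n t with inB-copy₂₁ G c (a , qa) b t
      ... | ab , nb = ⊥-elim (nb (nest I c a b bc (box-bang G a b bb ab) qa ab))

  predBound-expFirst : (G : Graph S) → BoxLaws G → (c b : V G) → Bang G c → Bang G b → (p : InBox G c c) →
                       {n : ℕ} → PredBound G b n → PredBound (EXP G c p) (inj₁ b , expKeep-first G c b p) n
  predBound-expFirst G I c b bc bb p P =
    predBound-fullSub (COPY G c) (expKeep G c p) (inj₁ b) _ (predBound-copyFirst G I c b bc bb P)

  -- After EXP_c with c a strict predecessor of b, the second copy of b has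
  -- strictly fewer predecessors: the copy of c itself was dropped.
  predBound-expSecond : (G : Graph S) (c b : V G) (p : InBox G c c) (y : InBox G c b) (ne : b ≢ c) {n : ℕ} →
                        PredBound G b (suc n) → PredBound (EXP G c p) (inj₂ (b , y) , expKeep-second G c b p y ne) n
  predBound-expSecond G c b p y ne {n} (predBound xs lx cover) =
    predBound ys shorter (covers-fullSub (COPY G c) (expKeep G c p) (inj₂ (b , y)) _ _ cover₂)
    where
      ys : List (V (EXP G c p))
      ys = sublist (expKeep G c p) (map (embed G c) xs)
      c∉ : ¬ T (expKeep G c p (embed G c c))
      c∉ t = T-not⁻ (subst (T ∘ expKeep G c p) (embed-in G c c p) t)
                    (fromWitness {a? = _≟V_ (COPY G c) (inj₂ (c , p)) _} refl)
      shorter : length ys ≤ n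
      shorter = ≤-pred (≤-trans (sublist-length-< _ _ _ (∈-map⁺ (embed G c) (cover c (λ e → ne (sym e)) y)) c∉)
                                (≤-trans (≤-reflexive (length-map (embed G c) xs)) lx))
      cover₂ : Covers (COPY G c) (inj₂ (b , y)) (map (embed G c) xs)
      cover₂ (inj₁ a) _ t with inB-copy₁₂ G c a (b , y) t
      ... | ab , na = subst (_∈ map (embed G c) xs) (embed-out G c a na)
                        (∈-map⁺ (embed G c) (cover a (λ { refl → na y }) ab))
      cover₂ (inj₂ (a , qa)) a≢b t =
        subst (_∈ map (embed G c) xs) (embed-in G c a qa)
          (∈-map⁺ (embed G c) (cover a (λ { refl → a≢b (cong inj₂ (ΣT-≡ {p = inB G c} refl)) })
                                       (subst T (inB-copy₂₂ G c _ _) t)))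

module _ {S : Sig} where
  open Graph

  -- The length of an ENF instantiation; with enf-transport it is the second
  -- component of the termination measure.
  enfLength : {G H : Graph S} → ENFInstantiation G H → ℕ
  enfLength (done _) = 0
  enfLength (exp _ _ _ _ r) = suc (enfLength r)
  enfLength (kill _ _ _ r) = suc (enfLength r)

  iso-InBox : {G H : Graph S} (I : Iso′ G H) (a b : V G) → InBox G a b → InBox H (fv I a) (fv I b)
  iso-InBox I a b t = subst T (sym (iso-inB I a b)) t

  iso-InBox⁻ : {G H : Graph S} (I : Iso′ G H) (a b : V H) → InBox H a b → InBox G (gv I a) (gv I b)
  iso-InBox⁻ I a b t = iso-InBox (isoSym I) a b t

  iso-Bang : {G H : Graph S} (I : Iso′ G H) (a : V G) → Bang G a → Bang H (fv I a)
  iso-Bang I a t = subst T (sym (iso-isBang I a)) t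

  iso-Depth0 : {G H : Graph S} (I : Iso′ G H) (b : V G) → Depth0 G b → Depth0 H (fv I b)
  iso-Depth0 {G} {H} I b d = depth0⁺ H _ λ a t →
    trans (sym (fvgv I a))
          (cong (fv I) (depth0⁻ G b d (gv I a) (subst (InBox G (gv I a)) (gvfv I b) (iso-InBox⁻ I a _ t))))

  enf-transport : {G₁ G₂ H : Graph S} → ENFInstantiation G₁ H → Iso′ G₁ G₂ → ENFInstantiation G₂ H
  enf-transport (done J) I = done (toIso (isoTrans (isoSym I) (fromIso J)))
  enf-transport (exp b bb d p r) I =
    exp (fv I b) (iso-Bang I b bb) (iso-Depth0 I b d) (iso-InBox I b b p) (enf-transport r (EXP-cong I b p (iso-InBox I b b p)))
  enf-transport (kill b bb d r) I = kill (fv I b) (iso-Bang I b bb) (iso-Depth0 I b d) (enf-transport r (KILL-cong I b))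

  enf-transport-length : {G₁ G₂ H : Graph S} (r : ENFInstantiation G₁ H) (I : Iso′ G₁ G₂) →
                         enfLength (enf-transport r I) ≡ enfLength r
  enf-transport-length (done J) I = refl
  enf-transport-length (exp b bb d p r) I = cong suc (enf-transport-length r _)
  enf-transport-length (kill b bb d r) I = cong suc (enf-transport-length r _)

  enf-transport-≤ : {G₁ G₂ H : Graph S} (r : ENFInstantiation G₁ H) (I : Iso′ G₁ G₂) {m : ℕ} →
                    enfLength r ≤ m → enfLength (enf-transport r I) ≤ m
  enf-transport-≤ r I l = ≤-trans (≤-reflexive (enf-transport-length r I)) l

-- Each lemma identifies "an operation on b, then
-- a depth-0 operation on c" with "the operation on c, then operations on the
-- images of b".  When b ∉ B(c) the two operations simply commute; when
-- b ∈ B(c), EXP_c duplicates b and the operation on b is split into one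
-- operation per copy, while KILL_c absorbs it.
module _ {S : Sig} where
  open Graph

  -- the boolean identity behind expKill-split: a vertex of COPY_c G kept by
  -- EXP_c lies in neither box of the two copies of b iff it lies over a
  -- vertex outside B(b)
  ∧-split-box : ∀ d i B → d ∧ (not (not i ∧ B) ∧ not (i ∧ B)) ≡ not B ∧ d
  ∧-split-box true true true = refl
  ∧-split-box true true false = refl
  ∧-split-box true false true = refl
  ∧-split-box true false false = refl
  ∧-split-box false true true = refl
  ∧-split-box false true false = refl
  ∧-split-box false false true = refl
  ∧-split-box false false false = refl

  ∧-true : ∀ a → a ∧ true ≡ a
  ∧-true true = refl
  ∧-true false = refl

  module _ (G : Graph S) where
    killKill-swap : (b c : V G) (pc : T (outsideBox G b c)) (nb : ¬ InBox G c b) →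
                    Iso′ (KILL (KILL G b) (c , pc)) (KILL (KILL G c) (b , T-not⁺ nb))
    killKill-swap b c pc nb =
      isoTrans (KILL-fullSub G (outsideBox G b) c pc)
        (isoTrans (fullSub-ext G _ _ (λ v → ∧-comm (outsideBox G c v) (outsideBox G b v)))
                  (isoSym (KILL-fullSub G (outsideBox G c) b (T-not⁺ nb))))

    killDrop-absorb : (b c : V G) (pc : T (otherThan G b c)) → InBox G c b →
                      Iso′ (KILL (DROP G b) (c , pc)) (KILL G c)
    killDrop-absorb b c pc y =
      isoTrans (KILL-fullSub G (otherThan G b) c pc) (fullSub-ext G _ (outsideBox G c)
        (λ v → T-ext (λ t → T-∧⁺ (T-not⁺ (λ u → T-not⁻ t (subst (InBox G c) (sym (toWitness {a? = _≟V_ G v b} u)) y))) t)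
                     (λ t → ∧-r _ _ t)))

    killDrop-swap : (b c : V G) (pc : T (otherThan G b c)) (nb : ¬ InBox G c b) →
                    Iso′ (KILL (DROP G b) (c , pc)) (DROP (KILL G c) (b , T-not⁺ nb))
    killDrop-swap b c pc nb =
      isoTrans (KILL-fullSub G (otherThan G b) c pc)
        (isoTrans (fullSub-ext G _ _ (λ v → ∧-comm (outsideBox G c v) (otherThan G b v)))
                  (isoSym (DROP-fullSub G (outsideBox G c) b (T-not⁺ nb))))

    expKill-swap : (b c : V G) (pc : T (outsideBox G b c)) (p : InBox (KILL G b) (c , pc) (c , pc))
                   (p0 : InBox G c c) → ¬ InBox G c b →
                   Iso′ (EXP (KILL G b) (c , pc) p) (KILL (EXP G c p0) (inj₁ b , expKeep-first G c b p0))
    expKill-swap b c pc p p0 nb =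
      isoTrans (EXP-fullSub G (outsideBox G b) c pc p p0)
        (isoTrans (fullSub-ext (COPY G c) _ _ pw)
                  (isoSym (KILL-fullSub (COPY G c) (expKeep G c p0) (inj₁ b) (expKeep-first G c b p0))))
      where
        pw : ∀ x → expKeep G c p0 x ∧ outsideBox (COPY G c) (inj₁ b) x ≡ liftKeep G c (outsideBox G b) x ∧ expKeep G c p0 x
        pw x = trans (cong (expKeep G c p0 x ∧_) (cong not (inB-copyOutside G c b nb x)))
                 (trans (∧-comm (expKeep G c p0 x) _) (cong (_∧ expKeep G c p0 x) (sym (liftKeep-origin G c (outsideBox G b) x))))

    expDrop-swap : (b c : V G) (pc : T (otherThan G b c)) (p : InBox (DROP G b) (c , pc) (c , pc))
                   (p0 : InBox G c c) → ¬ InBox G c b →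
                   Iso′ (EXP (DROP G b) (c , pc) p) (DROP (EXP G c p0) (inj₁ b , expKeep-first G c b p0))
    expDrop-swap b c pc p p0 nb =
      isoTrans (EXP-fullSub G (otherThan G b) c pc p p0)
        (isoTrans (fullSub-ext C _ _ pw) (isoSym (DROP-fullSub C (expKeep G c p0) (inj₁ b) (expKeep-first G c b p0))))
      where
        C : Graph S
        C = COPY G c
        vb : ∀ v q → otherThan G b v ≡ true
        vb v q = cong not (¬T⇒≡false (λ u → nb (subst (InBox G c) (toWitness {a? = _≟V_ G v b} u) q)))
        pw : ∀ x → expKeep G c p0 x ∧ otherThan C (inj₁ b) x ≡ liftKeep G c (otherThan G b) x ∧ expKeep G c p0 x
        pw (inj₁ v) = trans (cong (λ z → expKeep G c p0 (inj₁ v) ∧ not z) (≟-copy₁₁ G c v b))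
                            (∧-comm (expKeep G c p0 (inj₁ v)) (otherThan G b v))
        pw (inj₂ (v , q)) = trans (cong (λ z → expKeep G c p0 (inj₂ (v , q)) ∧ not z) (≟-copy₂₁ G c b (v , q)))
                                  (trans (∧-true _) (sym (cong (_∧ expKeep G c p0 (inj₂ (v , q))) (vb v q))))

    expDrop-split : (b c : V G) (pc : T (otherThan G b c)) (p : InBox (DROP G b) (c , pc) (c , pc))
                    (p0 : InBox G c c) (y : InBox G c b) (ne : b ≢ c) →
                    let b₁ = inj₁ b , expKeep-first G c b p0
                        b₂ = inj₂ (b , y) , expKeep-second G c b p0 y ne in
                    (d : T (otherThan (EXP G c p0) b₂ b₁)) →
                    Iso′ (EXP (DROP G b) (c , pc) p) (DROP (DROP (EXP G c p0) b₂) (b₁ , d))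
    expDrop-split b c pc p p0 y ne d =
      isoTrans (EXP-fullSub G (otherThan G b) c pc p p0) (isoTrans (fullSub-ext C _ _ pw) (isoSym R))
      where
        C X : Graph S
        C = COPY G c
        X = EXP G c p0
        b₁ b₂ : V X
        b₁ = inj₁ b , expKeep-first G c b p0
        b₂ = inj₂ (b , y) , expKeep-second G c b p0 y ne
        R : Iso′ (DROP (DROP X b₂) (b₁ , d)) (fullSub C (λ x → expKeep G c p0 x ∧ (otherThan C (inj₂ (b , y)) x ∧ otherThan C (inj₁ b) x)))
        R = isoTrans (DROP-fullSub X (otherThan X b₂) b₁ d)
                     (fullSub-fullSub∧ C (expKeep G c p0) (λ v → otherThan X b₂ v ∧ otherThan X b₁ v)
                        (λ x → otherThan C (inj₂ (b , y)) x ∧ otherThan C (inj₁ b) x)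
                        (λ v q → cong₂ _∧_ (cong not (≟-fullSub C (expKeep G c p0) (v , q) b₂))
                                           (cong not (≟-fullSub C (expKeep G c p0) (v , q) b₁))))
        pw : ∀ x → expKeep G c p0 x ∧ (otherThan C (inj₂ (b , y)) x ∧ otherThan C (inj₁ b) x) ≡
                   liftKeep G c (otherThan G b) x ∧ expKeep G c p0 x
        pw (inj₁ v) = trans (cong (expKeep G c p0 (inj₁ v) ∧_) (cong₂ _∧_ (cong not (≟-copy₁₂ G c v (b , y))) (cong not (≟-copy₁₁ G c v b))))
                            (∧-comm (expKeep G c p0 (inj₁ v)) (otherThan G b v))
        pw (inj₂ (v , q)) =
          trans (cong (expKeep G c p0 (inj₂ (v , q)) ∧_) (cong₂ _∧_ (cong not (≟-copy₂₂ G c (v , q) (b , y))) (cong not (≟-copy₂₁ G c b (v , q)))))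
                (trans (cong (expKeep G c p0 (inj₂ (v , q)) ∧_) (∧-true (otherThan G b v)))
                       (∧-comm (expKeep G c p0 (inj₂ (v , q))) (otherThan G b v)))

    killExp-drop : (b : V G) (p : InBox G b b) → Iso′ (KILL (EXP G b p) (inj₁ b , expKeep-first G b b p)) (DROP G b)
    killExp-drop b p =
      isoTrans (KILL-fullSub C (expKeep G b p) (inj₁ b) (expKeep-first G b b p)) (fullSub-embedded G b K (otherThan G b) h1 h1' h2)
      where
        C : Graph S
        C = COPY G b
        K : V C → Bool
        K x = expKeep G b p x ∧ outsideBox C (inj₁ b) x
        h1 : ∀ v → ¬ InBox G b v → K (inj₁ v) ≡ otherThan G b v
        h1 v nb = T-ext (λ _ → T-not⁺ (λ u → nb (subst (InBox G b) (sym (toWitness {a? = _≟V_ G v b} u)) p)))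
                        (λ _ → T-∧⁺ (T-not⁺ (λ u → inj₁≢inj₂ (toWitness {a? = _≟V_ C (inj₁ v) (inj₂ (b , p))} u)))
                                    (T-not⁺ (λ u → nb (subst T (inB-copy₁₁ G b b v) u))))
        h1' : ∀ v → InBox G b v → K (inj₁ v) ≡ false
        h1' v q = ¬T⇒≡false (λ t → T-not⁻ (∧-r _ _ t) (subst T (sym (inB-copy₁₁ G b b v)) q))
        h2 : ∀ x → K (inj₂ x) ≡ otherThan G b (proj₁ x)
        h2 (v , q) = trans (cong₂ _∧_ (cong not (≟-copy₂₂ G b (v , q) (b , p))) (cong not (inB-copyFirst G b b p (inj₂ (v , q)))))
                           (∧-true _)

    killCopy-swap : (b c : V G) → ¬ InBox G b c → (nb : ¬ InBox G c b) →
                    Iso′ (KILL (COPY G b) (inj₁ c)) (COPY (KILL G c) (b , T-not⁺ nb))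
    killCopy-swap b c nbc nb =
      isoTrans (fullSub-ext (COPY G b) (outsideBox (COPY G b) (inj₁ c)) (liftKeep G b (outsideBox G c))
                 (λ x → trans (liftKeep-origin G b (outsideBox G c) x) (cong not (sym (inB-copyOutside G b c nbc x)))))
               (isoSym (COPY-fullSub G (outsideBox G c) b (T-not⁺ nb)))

  module _ (G : Graph S) (I : BoxLaws G) where
    killKill-absorb : (b c : V G) → Bang G b → Bang G c → (pc : T (outsideBox G b c)) → InBox G c b →
                      Iso′ (KILL (KILL G b) (c , pc)) (KILL G c)
    killKill-absorb b c bb bc pc y =
      isoTrans (KILL-fullSub G (outsideBox G b) c pc) (fullSub-ext G _ (outsideBox G c)
        (λ v → T-ext (λ t → T-∧⁺ (T-not⁺ (λ u → T-not⁻ t (nest I c b v bc bb y u))) t) (λ t → ∧-r _ _ t)))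

    expKill-split : (b c : V G) → Bang G b → Bang G c → (pc : T (outsideBox G b c))
                    (p : InBox (KILL G b) (c , pc) (c , pc)) (p0 : InBox G c c) (y : InBox G c b) (ne : b ≢ c) →
                    let b₁ = inj₁ b , expKeep-first G c b p0
                        b₂ = inj₂ (b , y) , expKeep-second G c b p0 y ne in
                    (d : T (outsideBox (EXP G c p0) b₂ b₁)) →
                    Iso′ (EXP (KILL G b) (c , pc) p) (KILL (KILL (EXP G c p0) b₂) (b₁ , d))
    expKill-split b c bb bc pc p p0 y ne d =
      isoTrans (EXP-fullSub G (outsideBox G b) c pc p p0) (isoTrans (fullSub-ext C _ _ pw) (isoSym R))
      where
        C X : Graph S
        C = COPY G c
        X = EXP G c p0
        b₁ b₂ : V X
        b₁ = inj₁ b , expKeep-first G c b p0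
        b₂ = inj₂ (b , y) , expKeep-second G c b p0 y ne
        R : Iso′ (KILL (KILL X b₂) (b₁ , d)) (fullSub C (λ x → expKeep G c p0 x ∧ (outsideBox C (inj₂ (b , y)) x ∧ outsideBox C (inj₁ b) x)))
        R = isoTrans (KILL-fullSub X (outsideBox X b₂) b₁ d)
                     (fullSub-fullSub∧ C (expKeep G c p0) (λ v → outsideBox X b₂ v ∧ outsideBox X b₁ v)
                        (λ x → outsideBox C (inj₂ (b , y)) x ∧ outsideBox C (inj₁ b) x)
                        (λ v q → cong₂ _∧_ (cong not (inB-fullSub C (expKeep G c p0) b₂ (v , q)))
                                           (cong not (inB-fullSub C (expKeep G c p0) b₁ (v , q)))))
        pw : ∀ x → expKeep G c p0 x ∧ (outsideBox C (inj₂ (b , y)) x ∧ outsideBox C (inj₁ b) x) ≡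
                   liftKeep G c (outsideBox G b) x ∧ expKeep G c p0 x
        pw x = trans (cong (expKeep G c p0 x ∧_) (cong₂ _∧_ (cong not (inB-copySecond G I c b bc bb y x)) (cong not (inB-copyFirst G c b y x))))
                     (trans (∧-split-box (expKeep G c p0 x) (isFirst x) (inB G b (origin G c x)))
                            (cong (_∧ expKeep G c p0 x) (sym (liftKeep-origin G c (outsideBox G b) x))))

    killCopy-secondSelf : (b : V G) → Bang G b → (q : InBox G b b) → Iso′ (KILL (COPY G b) (inj₂ (b , q))) G
    killCopy-secondSelf b bb q =
      isoTrans (fullSub-firstCopies G b (outsideBox (COPY G b) (inj₂ (b , q))) (λ _ → true) h1 h2) (fullSub-all G (λ _ → true) (λ _ → tt))
      where
        h1 : ∀ v → outsideBox (COPY G b) (inj₂ (b , q)) (inj₁ v) ≡ true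
        h1 v = cong not (inB-copySecond G I b b bb bb q (inj₁ v))
        h2 : ∀ x → outsideBox (COPY G b) (inj₂ (b , q)) (inj₂ x) ≡ false
        h2 (v , r) = trans (cong not (inB-copySecond G I b b bb bb q (inj₂ (v , r)))) (cong not (T⇒≡true r))

    killCopy-firstSelf : (b : V G) → Bang G b → Iso′ (KILL (COPY G b) (inj₁ b)) G
    killCopy-firstSelf b bb =
      isoTrans (fullSub-embedded G b (outsideBox (COPY G b) (inj₁ b)) (λ _ → true) h1 h1' h2) (fullSub-all G (λ _ → true) (λ _ → tt))
      where
        h1 : ∀ v → ¬ InBox G b v → outsideBox (COPY G b) (inj₁ b) (inj₁ v) ≡ true
        h1 v nb = trans (cong not (inB-copy₁₁ G b b v)) (cong not (¬T⇒≡false nb))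
        h1' : ∀ v → InBox G b v → outsideBox (COPY G b) (inj₁ b) (inj₁ v) ≡ false
        h1' v q = trans (cong not (inB-copy₁₁ G b b v)) (cong not (T⇒≡true q))
        h2 : ∀ x → outsideBox (COPY G b) (inj₁ b) (inj₂ x) ≡ true
        h2 (v , q) = cong not (inB-copyFirst G b b (loop I b bb) (inj₂ (v , q)))

    killCopy-absorb : (b c : V G) → Bang G b → Bang G c → ¬ InBox G b c → InBox G c b →
                      Iso′ (KILL (COPY G b) (inj₁ c)) (KILL G c)
    killCopy-absorb b c bb bc nbc y =
      fullSub-firstCopies G b (outsideBox (COPY G b) (inj₁ c)) (outsideBox G c) (λ v → cong not (inB-copy₁₁ G b c v))
        (λ { (v , q) → cong not (trans (inB-copyOutside G b c nbc (inj₂ (v , q))) (T⇒≡true (nest I c b v bc bb y q))) })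

module _ {S : Sig} where
  open Graph

  module SwapCopies (G : Graph S) (b : V G) where
    private
      C : Graph S
      C = COPY G b
      keb : E G → Bool
      keb = Copied G b

    σv : V C → V C
    σv (inj₁ v) = embed G b v
    σv (inj₂ (v , q)) = inj₁ v

    embED : (e : E G) → Dec (T (keb e)) → E C
    embED e (yes p) = inj₂ (e , p)
    embED e (no _) = inj₁ e

    σe : E C → E C
    σe (inj₁ e) = embED e (T? (keb e))
    σe (inj₂ (e , p)) = inj₁ e

    σemb : ∀ v → σv (embed G b v) ≡ inj₁ v
    σemb v with T? (inB G b v)
    ... | yes q = refl
    ... | no n = embed-out G b v n

    σσv : ∀ x → σv (σv x) ≡ x
    σσv (inj₁ v) = σemb v
    σσv (inj₂ (v , q)) = embed-in G b v q

    σe-no : ∀ e → ¬ T (keb e) → σe (inj₁ e) ≡ inj₁ e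
    σe-no e n with T? (keb e)
    ... | yes p = ⊥-elim (n p)
    ... | no _ = refl

    σσe : ∀ x → σe (σe x) ≡ x
    σσe (inj₁ e) with T? (keb e)
    ... | yes p = refl
    ... | no n = σe-no e n
    σσe (inj₂ (e , p)) with T? (keb e)
    ... | yes p' = cong inj₂ (ΣT-≡ {p = keb} refl)
    ... | no n = ⊥-elim (n p)

    psrcσ : ∀ x → src C (σe x) ≡ σv (src C x)
    psrcσ (inj₁ e) with T? (keb e)
    ... | yes p = src-copy G b e p
    ... | no n = sym (embed-out G b _ (λ q → n (T-∨⁺ˡ q)))
    psrcσ (inj₂ (e , p)) = sym (trans (cong σv (src-copy G b e p)) (σemb _))

    ptgtσ : ∀ x → tgt C (σe x) ≡ σv (tgt C x)
    ptgtσ (inj₁ e) with T? (keb e)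
    ... | yes p = tgt-copy G b e p
    ... | no n = sym (embed-out G b _ (λ q → n (T-∨⁺ʳ q)))
    ptgtσ (inj₂ (e , p)) = sym (trans (cong σv (tgt-copy G b e p)) (σemb _))

    pvtyσ : ∀ x → vty C (σv x) ≡ vty C x
    pvtyσ (inj₁ v) = embed-vty G b v
    pvtyσ (inj₂ (v , q)) = refl

    petyσ : ∀ x → ety C (σe x) ≡ ety C x
    petyσ (inj₁ e) with T? (keb e)
    ... | yes p = refl
    ... | no n = refl
    petyσ (inj₂ (e , p)) = refl

    isoσ : Iso′ C C
    isoσ = record { fv = σv ; gv = σv ; fvgv = σσv ; gvfv = σσv ; fe = σe ; ge = σe ; fege = σσe ; gefe = σσe
                  ; psrc = psrcσ ; ptgt = ptgtσ ; pvty = pvtyσ ; pety = petyσ }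

  -- COPY_{b⁰} (COPY_b G) holds three copies of B(b): the original, the one
  -- made by COPY_b and the one made by COPY_{b⁰}; τ exchanges the last two.
  module ExchangeCopies (G : Graph S) (b : V G) (pb : InBox G b b) where
    private
      C D : Graph S
      C = COPY G b
      D = COPY C (inj₁ b)
      keb : E G → Bool
      keb = Copied G b
      B1 : V C → Bool
      B1 = inB C (inj₁ b)
      ke1 : E C → Bool
      ke1 e = B1 (src C e) ∨ B1 (tgt C e)
      c11 : ∀ v → T (inB G b v) → T (B1 (inj₁ v))
      c11 v q = subst T (sym (inB-copy₁₁ G b b v)) q
      c11⁻ : ∀ v → T (B1 (inj₁ v)) → T (inB G b v)
      c11⁻ v q = subst T (inB-copy₁₁ G b b v) q
      no2 : ∀ x → ¬ T (B1 (inj₂ x))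
      no2 x t = subst T (inB-copyFirst G b b pb (inj₂ x)) t
      keq : ∀ e → ke1 (inj₁ e) ≡ keb e
      keq e = cong₂ _∨_ (inB-copy₁₁ G b b _) (inB-copy₁₁ G b b _)
      B1emb : ∀ v → B1 (embed G b v) ≡ false
      B1emb v with T? (inB G b v)
      ... | yes q = ¬T⇒≡false (no2 (v , q))
      ... | no n = trans (inB-copy₁₁ G b b v) (¬T⇒≡false n)
      no22 : ∀ e p → ¬ T (ke1 (inj₂ (e , p)))
      no22 e p t with T-∨⁻ t
      ... | inj₁ u = subst T (trans (cong B1 (src-copy G b e p)) (B1emb _)) u
      ... | inj₂ u = subst T (trans (cong B1 (tgt-copy G b e p)) (B1emb _)) u

    τv : V D → V D
    τv (inj₁ (inj₁ v)) = inj₁ (inj₁ v)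
    τv (inj₁ (inj₂ (v , q))) = inj₂ (inj₁ v , c11 v q)
    τv (inj₂ (inj₁ v , q)) = inj₁ (inj₂ (v , c11⁻ v q))
    τv (inj₂ (inj₂ x , q)) = ⊥-elim (no2 x q)

    τe : E D → E D
    τe (inj₁ (inj₁ e)) = inj₁ (inj₁ e)
    τe (inj₁ (inj₂ (e , p))) = inj₂ (inj₁ e , subst T (sym (keq e)) p)
    τe (inj₂ (inj₁ e , p)) = inj₁ (inj₂ (e , subst T (keq e) p))
    τe (inj₂ (inj₂ (e , p) , p')) = ⊥-elim (no22 e p p')

    ττv : ∀ x → τv (τv x) ≡ x
    ττv (inj₁ (inj₁ v)) = refl
    ττv (inj₁ (inj₂ (v , q))) = cong inj₁ (cong inj₂ (ΣT-≡ {p = inB G b} refl))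
    ττv (inj₂ (inj₁ v , q)) = cong inj₂ (ΣT-≡ {p = B1} refl)
    ττv (inj₂ (inj₂ x , q)) = ⊥-elim (no2 x q)

    ττe : ∀ x → τe (τe x) ≡ x
    ττe (inj₁ (inj₁ e)) = refl
    ττe (inj₁ (inj₂ (e , p))) = cong inj₁ (cong inj₂ (ΣT-≡ {p = keb} refl))
    ττe (inj₂ (inj₁ e , p)) = cong inj₂ (ΣT-≡ {p = ke1} refl)
    ττe (inj₂ (inj₂ (e , p) , p')) = ⊥-elim (no22 e p p')

    τn1 : ∀ v → embed C (inj₁ b) (inj₁ v) ≡ τv (inj₁ (embed G b v))
    τn1 v with T? (inB G b v)
    ... | yes q = embed-in C (inj₁ b) (inj₁ v) (c11 v q)
    ... | no n = embed-out C (inj₁ b) (inj₁ v) (λ t → n (c11⁻ v t))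

    τn2 : ∀ v → τv (embed C (inj₁ b) (inj₁ v)) ≡ inj₁ (embed G b v)
    τn2 v = trans (cong τv (τn1 v)) (ττv _)

    psrcτ : ∀ x → src D (τe x) ≡ τv (src D x)
    psrcτ (inj₁ (inj₁ e)) = refl
    psrcτ (inj₁ (inj₂ (e , p))) =
      trans (src-copy C (inj₁ b) (inj₁ e) (subst T (sym (keq e)) p))
            (trans (τn1 (src G e)) (cong (λ z → τv (inj₁ z)) (sym (src-copy G b e p))))
    psrcτ (inj₂ (inj₁ e , p)) =
      trans (cong inj₁ (src-copy G b e (subst T (keq e) p)))
            (sym (trans (cong τv (src-copy C (inj₁ b) (inj₁ e) p)) (τn2 (src G e))))
    psrcτ (inj₂ (inj₂ (e , p) , p')) = ⊥-elim (no22 e p p')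

    ptgtτ : ∀ x → tgt D (τe x) ≡ τv (tgt D x)
    ptgtτ (inj₁ (inj₁ e)) = refl
    ptgtτ (inj₁ (inj₂ (e , p))) =
      trans (tgt-copy C (inj₁ b) (inj₁ e) (subst T (sym (keq e)) p))
            (trans (τn1 (tgt G e)) (cong (λ z → τv (inj₁ z)) (sym (tgt-copy G b e p))))
    ptgtτ (inj₂ (inj₁ e , p)) =
      trans (cong inj₁ (tgt-copy G b e (subst T (keq e) p)))
            (sym (trans (cong τv (tgt-copy C (inj₁ b) (inj₁ e) p)) (τn2 (tgt G e))))
    ptgtτ (inj₂ (inj₂ (e , p) , p')) = ⊥-elim (no22 e p p')

    pvtyτ : ∀ x → vty D (τv x) ≡ vty D x
    pvtyτ (inj₁ (inj₁ v)) = refl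
    pvtyτ (inj₁ (inj₂ (v , q))) = refl
    pvtyτ (inj₂ (inj₁ v , q)) = refl
    pvtyτ (inj₂ (inj₂ x , q)) = ⊥-elim (no2 x q)

    petyτ : ∀ x → ety D (τe x) ≡ ety D x
    petyτ (inj₁ (inj₁ e)) = refl
    petyτ (inj₁ (inj₂ (e , p))) = refl
    petyτ (inj₂ (inj₁ e , p)) = refl
    petyτ (inj₂ (inj₂ (e , p) , p')) = ⊥-elim (no22 e p p')

    isoτ : Iso′ D D
    isoτ = record { fv = τv ; gv = τv ; fvgv = ττv ; gvfv = ττv ; fe = τe ; ge = τe ; fege = ττe ; gefe = ττe
                  ; psrc = psrcτ ; ptgt = ptgtτ ; pvty = pvtyτ ; pety = petyτ }

    expCopy-self : (p : InBox C (inj₁ b) (inj₁ b)) → Iso′ (EXP C (inj₁ b) p) (COPY (EXP G b pb) (inj₁ b , expKeep-first G b b pb))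
    expCopy-self p = isoTrans (fullSub-cong isoτ (expKeep C (inj₁ b) p) (liftKeep C (inj₁ b) (expKeep G b pb)) pw)
                     (isoSym (COPY-fullSub C (expKeep G b pb) (inj₁ b) (expKeep-first G b b pb)))
      where
        pw : ∀ z → liftKeep C (inj₁ b) (expKeep G b pb) (τv z) ≡ expKeep C (inj₁ b) p z
        pw (inj₁ (inj₁ v)) = trans (cong not (≟-copy₁₂ G b v (b , pb))) (sym (cong not (≟-copy₁₂ C (inj₁ b) (inj₁ v) (inj₁ b , p))))
        pw (inj₁ (inj₂ (v , q))) = trans (cong not (≟-copy₁₂ G b v (b , pb))) (sym (cong not (≟-copy₁₂ C (inj₁ b) (inj₂ (v , q)) (inj₁ b , p))))
        pw (inj₂ (inj₁ v , q)) = trans (cong not (≟-copy₂₂ G b (v , _) (b , pb)))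
                                   (sym (trans (cong not (≟-copy₂₂ C (inj₁ b) (inj₁ v , q) (inj₁ b , p))) (cong not (≟-copy₁₁ G b v b))))
        pw (inj₂ (inj₂ x , q)) = ⊥-elim (no2 x q)

  -- the same, for EXP of the second copy: transport along σ
  expCopy-selfSecond : (G : Graph S) (b : V G) (pb q : InBox G b b) (p : InBox (COPY G b) (inj₂ (b , q)) (inj₂ (b , q))) →
                       Iso′ (EXP (COPY G b) (inj₂ (b , q)) p) (COPY (EXP G b pb) (inj₁ b , expKeep-first G b b pb))
  expCopy-selfSecond G b pb q p = isoTrans (EXP-cong (SwapCopies.isoσ G b) (inj₂ (b , q)) p p′) (ExchangeCopies.expCopy-self G b pb p′)
    where
      p′ : InBox (COPY G b) (SwapCopies.σv G b (inj₂ (b , q))) (SwapCopies.σv G b (inj₂ (b , q)))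
      p′ = iso-InBox (SwapCopies.isoσ G b) (inj₂ (b , q)) (inj₂ (b , q)) p

module _ {S : Sig} where
  open Graph

  module IndependentCopies (G : Graph S) (b c : V G) (nbc : ¬ InBox G b c) (ncb : ¬ InBox G c b) where
    Cb Cc L R : Graph S
    Cb = COPY G b
    Cc = COPY G c
    L = COPY Cb (inj₁ c)
    R = COPY Cc (inj₁ b)
    BL : V Cb → Bool
    BL = inB Cb (inj₁ c)
    BR : V Cc → Bool
    BR = inB Cc (inj₁ b)
    fromL : ∀ y → T (BL y) → T (inB G c (origin G b y))
    fromL y t = subst T (inB-copyOutside G b c nbc y) t
    toL : ∀ y → T (inB G c (origin G b y)) → T (BL y)
    toL y t = subst T (sym (inB-copyOutside G b c nbc y)) t
    fromR : ∀ y → T (BR y) → T (inB G b (origin G c y))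
    fromR y t = subst T (inB-copyOutside G c b ncb y) t
    toR : ∀ y → T (inB G b (origin G c y)) → T (BR y)
    toR y t = subst T (sym (inB-copyOutside G c b ncb y)) t
    keb : E G → Bool
    keb = Copied G b
    kec : E G → Bool
    kec = Copied G c
    keL : E Cb → Bool
    keL e = BL (src Cb e) ∨ BL (tgt Cb e)
    keR : E Cc → Bool
    keR e = BR (src Cc e) ∨ BR (tgt Cc e)
    keL≡ : ∀ e → keL e ≡ kec (originE G b e)
    keL≡ = copyBoxEdges G b c nbc
    keR≡ : ∀ e → keR e ≡ keb (originE G c e)
    keR≡ = copyBoxEdges G c b ncb

    SWv : V L → V R
    SWv (inj₁ (inj₁ v)) = inj₁ (inj₁ v)
    SWv (inj₁ (inj₂ (v , qb))) = inj₂ (inj₁ v , toR (inj₁ v) qb)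
    SWv (inj₂ (inj₁ v , qc)) = inj₁ (inj₂ (v , fromL (inj₁ v) qc))
    SWv (inj₂ (inj₂ (v , qb) , qc)) = inj₂ (inj₂ (v , fromL (inj₂ (v , qb)) qc) , toR (inj₂ (v , fromL (inj₂ (v , qb)) qc)) qb)

    pR1 : ∀ e → T (keb e) → T (keR (inj₁ e))
    pR1 e pb = subst T (sym (keR≡ (inj₁ e))) pb
    pL1 : ∀ e → T (keL (inj₁ e)) → T (kec e)
    pL1 e pc = subst T (keL≡ (inj₁ e)) pc
    pL2 : ∀ e pb → T (keL (inj₂ (e , pb))) → T (kec e)
    pL2 e pb pc = subst T (keL≡ (inj₂ (e , pb))) pc
    pR2 : ∀ e pb pc → T (keR (inj₂ (e , pL2 e pb pc)))
    pR2 e pb pc = subst T (sym (keR≡ (inj₂ (e , pL2 e pb pc)))) pb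

    SWe : E L → E R
    SWe (inj₁ (inj₁ e)) = inj₁ (inj₁ e)
    SWe (inj₁ (inj₂ (e , pb))) = inj₂ (inj₁ e , pR1 e pb)
    SWe (inj₂ (inj₁ e , pc)) = inj₁ (inj₂ (e , pL1 e pc))
    SWe (inj₂ (inj₂ (e , pb) , pc)) = inj₂ (inj₂ (e , pL2 e pb pc) , pR2 e pb pc)

    n1 : ∀ v → SWv (inj₁ (embed G b v)) ≡ embed Cc (inj₁ b) (inj₁ v)
    n1 v with T? (inB G b v)
    ... | yes q = sym (embed-in Cc (inj₁ b) (inj₁ v) (toR (inj₁ v) q))
    ... | no n = sym (embed-out Cc (inj₁ b) (inj₁ v) (λ t → n (fromR (inj₁ v) t)))

    n2 : ∀ v → SWv (embed Cb (inj₁ c) (inj₁ v)) ≡ inj₁ (embed G c v)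
    n2 v with T? (inB Cb (inj₁ c) (inj₁ v))
    ... | yes t = cong inj₁ (sym (embed-in G c v (fromL (inj₁ v) t)))
    ... | no n = cong inj₁ (sym (embed-out G c v (λ q → n (toL (inj₁ v) q))))

    outR : ∀ y → ¬ T (inB G b (origin G c y)) → embed Cc (inj₁ b) y ≡ inj₁ y
    outR y n = embed-out Cc (inj₁ b) y (λ t → n (fromR y t))

    n3 : ∀ v → SWv (embed Cb (inj₁ c) (embed G b v)) ≡ embed Cc (inj₁ b) (embed G c v)
    n3 v with T? (inB G b v)
    ... | no nb = trans (n2 v) (sym (outR (embed G c v) (λ t → nb (subst (λ z → T (inB G b z)) (origin-embed G c v) t))))
    ... | yes qb with T? (inB Cb (inj₁ c) (inj₂ (v , qb)))
    ...   | yes t = sym (trans (cong (embed Cc (inj₁ b)) (embed-in G c v (fromL (inj₂ (v , qb)) t)))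
                              (embed-in Cc (inj₁ b) (inj₂ (v , fromL (inj₂ (v , qb)) t)) _))
    ...   | no n = sym (trans (cong (embed Cc (inj₁ b)) (embed-out G c v (λ q → n (toL (inj₂ (v , qb)) q))))
                              (embed-in Cc (inj₁ b) (inj₁ v) _))

    psrcSW : ∀ x → src R (SWe x) ≡ SWv (src L x)
    psrcSW (inj₁ (inj₁ e)) = refl
    psrcSW (inj₁ (inj₂ (e , pb))) =
      trans (src-copy Cc (inj₁ b) (inj₁ e) (pR1 e pb)) (trans (sym (n1 (src G e))) (cong (SWv ∘ inj₁) (sym (src-copy G b e pb))))
    psrcSW (inj₂ (inj₁ e , pc)) =
      trans (cong inj₁ (src-copy G c e (pL1 e pc))) (trans (sym (n2 _)) (cong SWv (sym (src-copy Cb (inj₁ c) (inj₁ e) pc))))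
    psrcSW (inj₂ (inj₂ (e , pb) , pc)) =
      trans (src-copy Cc (inj₁ b) (inj₂ (e , pL2 e pb pc)) (pR2 e pb pc)) (trans (cong (embed Cc (inj₁ b)) (src-copy G c e (pL2 e pb pc)))
        (trans (sym (n3 _)) (cong SWv (sym (trans (src-copy Cb (inj₁ c) (inj₂ (e , pb)) pc) (cong (embed Cb (inj₁ c)) (src-copy G b e pb)))))))

    ptgtSW : ∀ x → tgt R (SWe x) ≡ SWv (tgt L x)
    ptgtSW (inj₁ (inj₁ e)) = refl
    ptgtSW (inj₁ (inj₂ (e , pb))) =
      trans (tgt-copy Cc (inj₁ b) (inj₁ e) (pR1 e pb)) (trans (sym (n1 (tgt G e))) (cong (SWv ∘ inj₁) (sym (tgt-copy G b e pb))))
    ptgtSW (inj₂ (inj₁ e , pc)) =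
      trans (cong inj₁ (tgt-copy G c e (pL1 e pc))) (trans (sym (n2 _)) (cong SWv (sym (tgt-copy Cb (inj₁ c) (inj₁ e) pc))))
    ptgtSW (inj₂ (inj₂ (e , pb) , pc)) =
      trans (tgt-copy Cc (inj₁ b) (inj₂ (e , pL2 e pb pc)) (pR2 e pb pc)) (trans (cong (embed Cc (inj₁ b)) (tgt-copy G c e (pL2 e pb pc)))
        (trans (sym (n3 _)) (cong SWv (sym (trans (tgt-copy Cb (inj₁ c) (inj₂ (e , pb)) pc) (cong (embed Cb (inj₁ c)) (tgt-copy G b e pb)))))))

    pvtySW : ∀ x → vty R (SWv x) ≡ vty L x
    pvtySW (inj₁ (inj₁ v)) = refl
    pvtySW (inj₁ (inj₂ (v , qb))) = refl
    pvtySW (inj₂ (inj₁ v , qc)) = refl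
    pvtySW (inj₂ (inj₂ (v , qb) , qc)) = refl

    petySW : ∀ x → ety R (SWe x) ≡ ety L x
    petySW (inj₁ (inj₁ e)) = refl
    petySW (inj₁ (inj₂ (e , pb))) = refl
    petySW (inj₂ (inj₁ e , pc)) = refl
    petySW (inj₂ (inj₂ (e , pb) , pc)) = refl

  module IndependentCopiesInverse (G : Graph S) (b c : V G) (nbc : ¬ InBox G b c) (ncb : ¬ InBox G c b) where
    private
      module F1 = IndependentCopies G b c nbc ncb
      module F2 = IndependentCopies G c b ncb nbc

    inv1 : ∀ x → F2.SWv (F1.SWv x) ≡ x
    inv1 (inj₁ (inj₁ v)) = refl
    inv1 (inj₁ (inj₂ (v , qb))) = cong inj₁ (cong inj₂ (ΣT-≡ {p = inB G b} refl))
    inv1 (inj₂ (inj₁ v , qc)) = cong inj₂ (ΣT-≡ {p = F1.BL} refl)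
    inv1 (inj₂ (inj₂ (v , qb) , qc)) = cong inj₂ (ΣT-≡ {p = F1.BL} (cong inj₂ (ΣT-≡ {p = inB G b} refl)))

    invE1 : ∀ x → F2.SWe (F1.SWe x) ≡ x
    invE1 (inj₁ (inj₁ e)) = refl
    invE1 (inj₁ (inj₂ (e , pb))) = cong inj₁ (cong inj₂ (ΣT-≡ {p = F1.keb} refl))
    invE1 (inj₂ (inj₁ e , pc)) = cong inj₂ (ΣT-≡ {p = F1.keL} refl)
    invE1 (inj₂ (inj₂ (e , pb) , pc)) = cong inj₂ (ΣT-≡ {p = F1.keL} (cong inj₂ (ΣT-≡ {p = F1.keb} refl)))

  copyCopy-swap : (G : Graph S) (b c : V G) (nbc : ¬ InBox G b c) (ncb : ¬ InBox G c b) →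
                  Iso′ (COPY (COPY G b) (inj₁ c)) (COPY (COPY G c) (inj₁ b))
  copyCopy-swap G b c nbc ncb = record
    { fv = F1.SWv ; gv = F2.SWv
    ; fvgv = IndependentCopiesInverse.inv1 G c b ncb nbc ; gvfv = IndependentCopiesInverse.inv1 G b c nbc ncb
    ; fe = F1.SWe ; ge = F2.SWe
    ; fege = IndependentCopiesInverse.invE1 G c b ncb nbc ; gefe = IndependentCopiesInverse.invE1 G b c nbc ncb
    ; psrc = F1.psrcSW ; ptgt = F1.ptgtSW ; pvty = F1.pvtySW ; pety = F1.petySW }
    where
      module F1 = IndependentCopies G b c nbc ncb
      module F2 = IndependentCopies G c b ncb nbc

  expCopy-swap : (G : Graph S) (b c : V G) → ¬ InBox G b c → ¬ InBox G c b →
                 (p : InBox (COPY G b) (inj₁ c) (inj₁ c)) (p0 : InBox G c c) →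
                 Iso′ (EXP (COPY G b) (inj₁ c) p) (COPY (EXP G c p0) (inj₁ b , expKeep-first G c b p0))
  expCopy-swap G b c nbc ncb p p0 =
    isoTrans (fullSub-cong (copyCopy-swap G b c nbc ncb) (expKeep Cb (inj₁ c) p) (liftKeep Cc (inj₁ b) (expKeep G c p0)) pw)
             (isoSym (COPY-fullSub Cc (expKeep G c p0) (inj₁ b) (expKeep-first G c b p0)))
    where
      Cb Cc : Graph S
      Cb = COPY G b
      Cc = COPY G c
      module F1 = IndependentCopies G b c nbc ncb
      pw : ∀ z → liftKeep Cc (inj₁ b) (expKeep G c p0) (F1.SWv z) ≡ expKeep Cb (inj₁ c) p z
      pw (inj₁ (inj₁ v)) = trans (cong not (≟-copy₁₂ G c v (c , p0))) (sym (cong not (≟-copy₁₂ Cb (inj₁ c) (inj₁ v) (inj₁ c , p))))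
      pw (inj₁ (inj₂ (v , qb))) = trans (cong not (≟-copy₁₂ G c v (c , p0))) (sym (cong not (≟-copy₁₂ Cb (inj₁ c) (inj₂ (v , qb)) (inj₁ c , p))))
      pw (inj₂ (inj₁ v , qc)) = trans (cong not (≟-copy₂₂ G c (v , _) (c , p0)))
                                  (sym (trans (cong not (≟-copy₂₂ Cb (inj₁ c) (inj₁ v , qc) (inj₁ c , p))) (cong not (≟-copy₁₁ G b v c))))
      pw (inj₂ (inj₂ (v , qb) , qc)) =
        trans (trans (cong not (≟-copy₂₂ G c (v , _) (c , p0))) (cong not (¬T⇒≡false (λ u → nbc (subst (InBox G b) (toWitness {a? = _≟V_ G v c} u) qb)))))
              (sym (trans (cong not (≟-copy₂₂ Cb (inj₁ c) (inj₂ (v , qb) , qc) (inj₁ c , p))) (cong not (≟-copy₂₁ G b c (v , qb)))))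

module _ {S : Sig} where
  open Graph

  -- For b ∈ B(c) but c ∉ B(b): COPY_{c⁰} (COPY_b G) ≅ COPY_{b⁰} (COPY_{b¹} (COPY_c G)),
  -- i.e. copying c after b is copying c first and then both copies of b.
  module NestedCopies (G : Graph S) (I : BoxLaws G) (b c : V G) (bb : Bang G b) (bc : Bang G c)
                      (nbc : ¬ InBox G b c) (y : InBox G c b) where
    Cb Cc L K R : Graph S
    Cb = COPY G b
    L = COPY Cb (inj₁ c)
    Cc = COPY G c
    K = COPY Cc (inj₂ (b , y))
    R = COPY K (inj₁ (inj₁ b))
    BL : V Cb → Bool
    BL = inB Cb (inj₁ c)
    BK : V Cc → Bool
    BK = inB Cc (inj₂ (b , y))
    BR : V K → Bool
    BR = inB K (inj₁ (inj₁ b))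
    origK : V K → V Cc
    origK = origin Cc (inj₂ (b , y))
    eqBL : ∀ z → BL z ≡ inB G c (origin G b z)
    eqBL = inB-copyOutside G b c nbc
    eqBK : ∀ w → BK w ≡ not (isFirst w) ∧ inB G b (origin G c w)
    eqBK = inB-copySecond G I c b bc bb y
    nK : ¬ T (BK (inj₁ b))
    nK t = subst T (eqBK (inj₁ b)) t
    eqC1 : ∀ w → inB Cc (inj₁ b) w ≡ isFirst w ∧ inB G b (origin G c w)
    eqC1 = inB-copyFirst G c b y
    eqBR : ∀ z → BR z ≡ inB Cc (inj₁ b) (origK z)
    eqBR = inB-copyOutside Cc (inj₂ (b , y)) (inj₁ b) nK
    BR11 : ∀ v → BR (inj₁ (inj₁ v)) ≡ inB G b v
    BR11 v = trans (eqBR _) (eqC1 (inj₁ v))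
    BRno12 : ∀ w → ¬ T (BR (inj₁ (inj₂ w)))
    BRno12 w t = subst T (trans (eqBR _) (eqC1 (inj₂ w))) t
    BK1 : ∀ v → ¬ T (BK (inj₁ v))
    BK1 v t = subst T (eqBK (inj₁ v)) t
    BRno2 : ∀ w t → ¬ T (BR (inj₂ (w , t)))
    BRno2 (inj₁ v) t s = BK1 v t
    BRno2 (inj₂ u) t s = subst T (trans (eqBR _) (eqC1 (inj₂ u))) s
    BK2 : ∀ v q → BK (inj₂ (v , q)) ≡ inB G b v
    BK2 v q = eqBK (inj₂ (v , q))
    Bb→Bc : ∀ v → InBox G b v → InBox G c v
    Bb→Bc v t = nest I c b v bc bb y t
    BKemb : ∀ v → BK (embed G c v) ≡ inB G b v
    BKemb v with T? (inB G c v)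
    ... | yes q = BK2 v q
    ... | no n = trans (¬T⇒≡false (BK1 v)) (sym (¬T⇒≡false (λ t → n (Bb→Bc v t))))
    C1emb : ∀ v → inB Cc (inj₁ b) (embed G c v) ≡ false
    C1emb v with T? (inB G c v)
    ... | yes q = eqC1 (inj₂ (v , q))
    ... | no n = trans (eqC1 (inj₁ v)) (¬T⇒≡false (λ t → n (Bb→Bc v t)))

    keb : E G → Bool
    keb = Copied G b
    kec : E G → Bool
    kec = Copied G c
    keL : E Cb → Bool
    keL e = BL (src Cb e) ∨ BL (tgt Cb e)
    keK : E Cc → Bool
    keK e = BK (src Cc e) ∨ BK (tgt Cc e)
    keR : E K → Bool
    keR e = BR (src K e) ∨ BR (tgt K e)
    keC1 : E Cc → Bool
    keC1 e = inB Cc (inj₁ b) (src Cc e) ∨ inB Cc (inj₁ b) (tgt Cc e)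
    keL≡ : ∀ e → keL e ≡ kec (originE G b e)
    keL≡ = copyBoxEdges G b c nbc
    keR≡ : ∀ e → keR e ≡ keC1 (originE Cc (inj₂ (b , y)) e)
    keR≡ = copyBoxEdges Cc (inj₂ (b , y)) (inj₁ b) nK
    keK2 : ∀ e pc → keK (inj₂ (e , pc)) ≡ keb e
    keK2 e pc = cong₂ _∨_ (trans (cong BK (src-copy G c e pc)) (BKemb _)) (trans (cong BK (tgt-copy G c e pc)) (BKemb _))
    keK1 : ∀ e → ¬ T (keK (inj₁ e))
    keK1 e = ¬T-∨ (BK1 _) (BK1 _)
    keR11 : ∀ e → keR (inj₁ (inj₁ e)) ≡ keb e
    keR11 e = trans (keR≡ (inj₁ (inj₁ e))) (cong₂ _∨_ (inB-copy₁₁ G c b _) (inB-copy₁₁ G c b _))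
    keC1-2 : ∀ e pc → ¬ T (keC1 (inj₂ (e , pc)))
    keC1-2 e pc = ¬T-∨ (λ t → subst T (trans (cong (inB Cc (inj₁ b)) (src-copy G c e pc)) (C1emb _)) t)
                       (λ t → subst T (trans (cong (inB Cc (inj₁ b)) (tgt-copy G c e pc)) (C1emb _)) t)
    keRno12 : ∀ e pc → ¬ T (keR (inj₁ (inj₂ (e , pc))))
    keRno12 e pc t = keC1-2 e pc (subst T (keR≡ (inj₁ (inj₂ (e , pc)))) t)
    keRno2 : ∀ e' pk → ¬ T (keR (inj₂ (e' , pk)))
    keRno2 (inj₁ e) pk t = keK1 e pk
    keRno2 (inj₂ (e , pc)) pk t = keC1-2 e pc (subst T (keR≡ (inj₂ (inj₂ (e , pc) , pk))) t)

    qcL : ∀ z → T (BL z) → T (inB G c (origin G b z))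
    qcL z t = subst T (eqBL z) t
    qcL⁻ : ∀ z → T (inB G c (origin G b z)) → T (BL z)
    qcL⁻ z t = subst T (sym (eqBL z)) t

    NSv : V L → V R
    NSv (inj₁ (inj₁ v)) = inj₁ (inj₁ (inj₁ v))
    NSv (inj₁ (inj₂ (v , qb))) = inj₂ (inj₁ (inj₁ v) , subst T (sym (BR11 v)) qb)
    NSv (inj₂ (inj₁ v , qc)) = inj₁ (inj₁ (inj₂ (v , qcL (inj₁ v) qc)))
    NSv (inj₂ (inj₂ (v , qb) , qc)) = inj₁ (inj₂ (inj₂ (v , qcL (inj₂ (v , qb)) qc) , subst T (sym (BK2 v _)) qb))

    NSi : V R → V L
    NSi (inj₁ (inj₁ (inj₁ v))) = inj₁ (inj₁ v)
    NSi (inj₁ (inj₁ (inj₂ (v , qc)))) = inj₂ (inj₁ v , qcL⁻ (inj₁ v) qc)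
    NSi (inj₁ (inj₂ (inj₁ v , r))) = ⊥-elim (BK1 v r)
    NSi (inj₁ (inj₂ (inj₂ (v , qc) , r))) = inj₂ (inj₂ (v , subst T (BK2 v qc) r) , qcL⁻ (inj₂ (v , subst T (BK2 v qc) r)) qc)
    NSi (inj₂ (inj₁ (inj₁ v) , s)) = inj₁ (inj₂ (v , subst T (BR11 v) s))
    NSi (inj₂ (inj₁ (inj₂ w) , s)) = ⊥-elim (BRno12 w s)
    NSi (inj₂ (inj₂ (w , t) , s)) = ⊥-elim (BRno2 w t s)

    NSvi : ∀ z → NSv (NSi z) ≡ z
    NSvi (inj₁ (inj₁ (inj₁ v))) = refl
    NSvi (inj₁ (inj₁ (inj₂ (v , qc)))) = cong (λ x → inj₁ (inj₁ (inj₂ x))) (ΣT-≡ {p = inB G c} refl)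
    NSvi (inj₁ (inj₂ (inj₁ v , r))) = ⊥-elim (BK1 v r)
    NSvi (inj₁ (inj₂ (inj₂ (v , qc) , r))) = cong (λ x → inj₁ (inj₂ x)) (ΣT-≡ {p = BK} (cong inj₂ (ΣT-≡ {p = inB G c} refl)))
    NSvi (inj₂ (inj₁ (inj₁ v) , s)) = cong inj₂ (ΣT-≡ {p = BR} refl)
    NSvi (inj₂ (inj₁ (inj₂ w) , s)) = ⊥-elim (BRno12 w s)
    NSvi (inj₂ (inj₂ (w , t) , s)) = ⊥-elim (BRno2 w t s)

    NSiv : ∀ x → NSi (NSv x) ≡ x
    NSiv (inj₁ (inj₁ v)) = refl
    NSiv (inj₁ (inj₂ (v , qb))) = cong (λ x → inj₁ (inj₂ x)) (ΣT-≡ {p = inB G b} refl)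
    NSiv (inj₂ (inj₁ v , qc)) = cong inj₂ (ΣT-≡ {p = BL} refl)
    NSiv (inj₂ (inj₂ (v , qb) , qc)) = cong inj₂ (ΣT-≡ {p = BL} (cong inj₂ (ΣT-≡ {p = inB G b} refl)))

    pe1 : ∀ e → T (keb e) → T (keR (inj₁ (inj₁ e)))
    pe1 e t = subst T (sym (keR11 e)) t
    pe2 : ∀ e → T (keL (inj₁ e)) → T (kec e)
    pe2 e t = subst T (keL≡ (inj₁ e)) t
    pe3 : ∀ e pb → T (keL (inj₂ (e , pb))) → T (kec e)
    pe3 e pb t = subst T (keL≡ (inj₂ (e , pb))) t

    NSe : E L → E R
    NSe (inj₁ (inj₁ e)) = inj₁ (inj₁ (inj₁ e))
    NSe (inj₁ (inj₂ (e , pb))) = inj₂ (inj₁ (inj₁ e) , pe1 e pb)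
    NSe (inj₂ (inj₁ e , pc)) = inj₁ (inj₁ (inj₂ (e , pe2 e pc)))
    NSe (inj₂ (inj₂ (e , pb) , pc)) = inj₁ (inj₂ (inj₂ (e , pe3 e pb pc) , subst T (sym (keK2 e (pe3 e pb pc))) pb))

    NSei : E R → E L
    NSei (inj₁ (inj₁ (inj₁ e))) = inj₁ (inj₁ e)
    NSei (inj₁ (inj₁ (inj₂ (e , pc)))) = inj₂ (inj₁ e , subst T (sym (keL≡ (inj₁ e))) pc)
    NSei (inj₁ (inj₂ (inj₁ e , pk))) = ⊥-elim (keK1 e pk)
    NSei (inj₁ (inj₂ (inj₂ (e , pc) , pk))) = inj₂ (inj₂ (e , subst T (keK2 e pc) pk) , subst T (sym (keL≡ (inj₂ (e , subst T (keK2 e pc) pk)))) pc)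
    NSei (inj₂ (inj₁ (inj₁ e) , pr)) = inj₁ (inj₂ (e , subst T (keR11 e) pr))
    NSei (inj₂ (inj₁ (inj₂ (e , pc)) , pr)) = ⊥-elim (keRno12 e pc pr)
    NSei (inj₂ (inj₂ (e' , pk) , pr)) = ⊥-elim (keRno2 e' pk pr)

    NSeie : ∀ z → NSe (NSei z) ≡ z
    NSeie (inj₁ (inj₁ (inj₁ e))) = refl
    NSeie (inj₁ (inj₁ (inj₂ (e , pc)))) = cong (λ x → inj₁ (inj₁ (inj₂ x))) (ΣT-≡ {p = kec} refl)
    NSeie (inj₁ (inj₂ (inj₁ e , pk))) = ⊥-elim (keK1 e pk)
    NSeie (inj₁ (inj₂ (inj₂ (e , pc) , pk))) = cong (λ x → inj₁ (inj₂ x)) (ΣT-≡ {p = keK} (cong inj₂ (ΣT-≡ {p = kec} refl)))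
    NSeie (inj₂ (inj₁ (inj₁ e) , pr)) = cong inj₂ (ΣT-≡ {p = keR} refl)
    NSeie (inj₂ (inj₁ (inj₂ (e , pc)) , pr)) = ⊥-elim (keRno12 e pc pr)
    NSeie (inj₂ (inj₂ (e' , pk) , pr)) = ⊥-elim (keRno2 e' pk pr)

    NSeei : ∀ x → NSei (NSe x) ≡ x
    NSeei (inj₁ (inj₁ e)) = refl
    NSeei (inj₁ (inj₂ (e , pb))) = cong (λ x → inj₁ (inj₂ x)) (ΣT-≡ {p = keb} refl)
    NSeei (inj₂ (inj₁ e , pc)) = cong inj₂ (ΣT-≡ {p = keL} refl)
    NSeei (inj₂ (inj₂ (e , pb) , pc)) = cong inj₂ (ΣT-≡ {p = keL} (cong inj₂ (ΣT-≡ {p = keb} refl)))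

    m1 : ∀ v → NSv (inj₁ (embed G b v)) ≡ embed K (inj₁ (inj₁ b)) (inj₁ (inj₁ v))
    m1 v with T? (inB G b v)
    ... | yes q = sym (embed-in K (inj₁ (inj₁ b)) (inj₁ (inj₁ v)) _)
    ... | no n = sym (embed-out K (inj₁ (inj₁ b)) (inj₁ (inj₁ v)) (λ t → n (subst T (BR11 v) t)))

    m2 : ∀ v → NSv (embed Cb (inj₁ c) (inj₁ v)) ≡ inj₁ (inj₁ (embed G c v))
    m2 v with T? (inB Cb (inj₁ c) (inj₁ v))
    ... | yes t = cong (λ x → inj₁ (inj₁ x)) (sym (embed-in G c v _))
    ... | no n = cong (λ x → inj₁ (inj₁ x)) (sym (embed-out G c v (λ q → n (qcL⁻ (inj₁ v) q))))

    m3 : ∀ v → NSv (embed Cb (inj₁ c) (embed G b v)) ≡ inj₁ (embed Cc (inj₂ (b , y)) (embed G c v))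
    m3 v with T? (inB G b v)
    ... | no nb = trans (m2 v) (cong inj₁ (sym (embed-out Cc (inj₂ (b , y)) (embed G c v) (λ t → nb (subst T (BKemb v) t)))))
    ... | yes qb with T? (inB Cb (inj₁ c) (inj₂ (v , qb)))
    ...   | no n = ⊥-elim (n (qcL⁻ (inj₂ (v , qb)) (Bb→Bc v qb)))
    ...   | yes t = cong inj₁ (sym (trans (cong (embed Cc (inj₂ (b , y))) (embed-in G c v (qcL (inj₂ (v , qb)) t)))
                                         (embed-in Cc (inj₂ (b , y)) (inj₂ (v , _)) _)))

    psrcNS : ∀ x → src R (NSe x) ≡ NSv (src L x)
    psrcNS (inj₁ (inj₁ e)) = refl
    psrcNS (inj₁ (inj₂ (e , pb))) =
      trans (src-copy K (inj₁ (inj₁ b)) (inj₁ (inj₁ e)) (pe1 e pb)) (trans (sym (m1 (src G e))) (cong (NSv ∘ inj₁) (sym (src-copy G b e pb))))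
    psrcNS (inj₂ (inj₁ e , pc)) =
      trans (cong (λ x → inj₁ (inj₁ x)) (src-copy G c e (pe2 e pc))) (trans (sym (m2 _)) (cong NSv (sym (src-copy Cb (inj₁ c) (inj₁ e) pc))))
    psrcNS (inj₂ (inj₂ (e , pb) , pc)) =
      trans (cong inj₁ (trans (src-copy Cc (inj₂ (b , y)) (inj₂ (e , pe3 e pb pc)) (subst T (sym (keK2 e (pe3 e pb pc))) pb))
                              (cong (embed Cc (inj₂ (b , y))) (src-copy G c e (pe3 e pb pc)))))
        (trans (sym (m3 _)) (cong NSv (sym (trans (src-copy Cb (inj₁ c) (inj₂ (e , pb)) pc) (cong (embed Cb (inj₁ c)) (src-copy G b e pb))))))

    ptgtNS : ∀ x → tgt R (NSe x) ≡ NSv (tgt L x)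
    ptgtNS (inj₁ (inj₁ e)) = refl
    ptgtNS (inj₁ (inj₂ (e , pb))) =
      trans (tgt-copy K (inj₁ (inj₁ b)) (inj₁ (inj₁ e)) (pe1 e pb)) (trans (sym (m1 (tgt G e))) (cong (NSv ∘ inj₁) (sym (tgt-copy G b e pb))))
    ptgtNS (inj₂ (inj₁ e , pc)) =
      trans (cong (λ x → inj₁ (inj₁ x)) (tgt-copy G c e (pe2 e pc))) (trans (sym (m2 _)) (cong NSv (sym (tgt-copy Cb (inj₁ c) (inj₁ e) pc))))
    ptgtNS (inj₂ (inj₂ (e , pb) , pc)) =
      trans (cong inj₁ (trans (tgt-copy Cc (inj₂ (b , y)) (inj₂ (e , pe3 e pb pc)) (subst T (sym (keK2 e (pe3 e pb pc))) pb))
                              (cong (embed Cc (inj₂ (b , y))) (tgt-copy G c e (pe3 e pb pc)))))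
        (trans (sym (m3 _)) (cong NSv (sym (trans (tgt-copy Cb (inj₁ c) (inj₂ (e , pb)) pc) (cong (embed Cb (inj₁ c)) (tgt-copy G b e pb))))))

    pvtyNS : ∀ x → vty R (NSv x) ≡ vty L x
    pvtyNS (inj₁ (inj₁ v)) = refl
    pvtyNS (inj₁ (inj₂ (v , qb))) = refl
    pvtyNS (inj₂ (inj₁ v , qc)) = refl
    pvtyNS (inj₂ (inj₂ (v , qb) , qc)) = refl

    petyNS : ∀ x → ety R (NSe x) ≡ ety L x
    petyNS (inj₁ (inj₁ e)) = refl
    petyNS (inj₁ (inj₂ (e , pb))) = refl
    petyNS (inj₂ (inj₁ e , pc)) = refl
    petyNS (inj₂ (inj₂ (e , pb) , pc)) = refl

    isoNS : Iso′ L R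
    isoNS = record { fv = NSv ; gv = NSi ; fvgv = NSvi ; gvfv = NSiv ; fe = NSe ; ge = NSei ; fege = NSeie ; gefe = NSeei
                   ; psrc = psrcNS ; ptgt = ptgtNS ; pvty = pvtyNS ; pety = petyNS }

  expCopy-split : (G : Graph S) → BoxLaws G → (b c : V G) → Bang G b → Bang G c → ¬ InBox G b c →
                  (y : InBox G c b) (ne : b ≢ c) (p : InBox (COPY G b) (inj₁ c) (inj₁ c)) (p0 : InBox G c c) →
                  Iso′ (EXP (COPY G b) (inj₁ c) p)
                       (COPY (COPY (EXP G c p0) (inj₂ (b , y) , expKeep-second G c b p0 y ne)) (inj₁ (inj₁ b , expKeep-first G c b p0)))
  expCopy-split G I b c bb bc nbc y ne p p0 =
    isoTrans (fullSub-cong (NS.isoNS) (expKeep Cb (inj₁ c) p) kR pw) (isoSym (isoTrans J2 J3))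
    where
      module NS = NestedCopies G I b c bb bc nbc y
      Cb Cc X : Graph S
      Cb = COPY G b
      Cc = COPY G c
      X = EXP G c p0
      b₁ b₂ : V X
      b₁ = inj₁ b , expKeep-first G c b p0
      b₂ = inj₂ (b , y) , expKeep-second G c b p0 y ne
      lk1 : V NS.K → Bool
      lk1 = liftKeep Cc (inj₂ (b , y)) (expKeep G c p0)
      kR : V NS.R → Bool
      kR = liftKeep NS.K (inj₁ (inj₁ b)) lk1
      J1 : Iso′ (COPY X b₂) (fullSub NS.K lk1)
      J1 = COPY-fullSub Cc (expKeep G c p0) (inj₂ (b , y)) (expKeep-second G c b p0 y ne)
      J2 : Iso′ (COPY (COPY X b₂) (inj₁ b₁)) (COPY (fullSub NS.K lk1) (fv J1 (inj₁ b₁)))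
      J2 = COPY-cong J1 (inj₁ b₁)
      J3 : Iso′ (COPY (fullSub NS.K lk1) (inj₁ (inj₁ b) , expKeep-first G c b p0)) (fullSub NS.R kR)
      J3 = COPY-fullSub NS.K lk1 (inj₁ (inj₁ b)) (expKeep-first G c b p0)
      pw : ∀ z → kR (NS.NSv z) ≡ expKeep Cb (inj₁ c) p z
      pw (inj₁ (inj₁ v)) = trans (cong not (≟-copy₁₂ G c v (c , p0))) (sym (cong not (≟-copy₁₂ Cb (inj₁ c) (inj₁ v) (inj₁ c , p))))
      pw (inj₁ (inj₂ (v , qb))) = trans (cong not (≟-copy₁₂ G c v (c , p0))) (sym (cong not (≟-copy₁₂ Cb (inj₁ c) (inj₂ (v , qb)) (inj₁ c , p))))
      pw (inj₂ (inj₁ v , qc)) = trans (cong not (≟-copy₂₂ G c (v , _) (c , p0)))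
                                  (sym (trans (cong not (≟-copy₂₂ Cb (inj₁ c) (inj₁ v , qc) (inj₁ c , p))) (cong not (≟-copy₁₁ G b v c))))
      pw (inj₂ (inj₂ (v , qb) , qc)) =
        trans (trans (cong not (≟-copy₂₂ G c (v , _) (c , p0))) (cong not (¬T⇒≡false (λ u → nbc (subst (InBox G b) (toWitness {a? = _≟V_ G v c} u) qb)))))
              (sym (trans (cong not (≟-copy₂₂ Cb (inj₁ c) (inj₂ (v , qb) , qc) (inj₁ c , p))) (cong not (≟-copy₂₁ G b c (v , qb)))))

module _ {S : Sig} where
  open Graph

  concrete-noBang : {G H : Graph S} → IsConcrete H → Iso G H → (x : V G) → Bang G x → ⊥
  concrete-noBang C J x bx = subst T (trans (sym (iso-isBang (fromIso J) x)) (C _)) bx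

  outsideBox-≢ : (G : Graph S) → BoxLaws G → (b c : V G) → Bang G b → T (outsideBox G b c) → b ≢ c
  outsideBox-≢ G I b .b bb pc refl = T-not⁻ pc (loop I b bb)

  otherThan-≢ : (G : Graph S) (b c : V G) → T (otherThan G b c) → b ≢ c
  otherThan-≢ G b .b pc refl = T-not⁻ pc (fromWitness {a? = _≟V_ G b b} refl)

  -- Depth 0 of c after KILL_b, DROP_b or COPY_b gives depth 0 of c in G:
  -- a strict predecessor of c in G would survive the operation on b, or
  -- (for KILL_b, DROP_b) force c itself to be removed.
  depth0-afterKill : (G : Graph S) → BoxLaws G → (b c : V G) → Bang G b → Bang G c →
                     (pc : T (outsideBox G b c)) → Depth0 (KILL G b) (c , pc) → Depth0 G c
  depth0-afterKill G I b c bb bc pc d = depth0⁺ G c onlyC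
    where
      onlyC : ∀ a → InBox G a c → a ≡ c
      onlyC a t with T? (inB G b a)
      ... | yes ba = ⊥-elim (T-not⁻ pc (nest I b a c bb (box-bang G a c bc t) ba t))
      ... | no na = cong proj₁ (depth0⁻ (KILL G b) (c , pc) d (a , T-not⁺ na)
                                        (subst T (sym (inB-fullSub G (outsideBox G b) _ _)) t))

  -- For DROP_b, the case that b itself is a predecessor of c is excluded by a
  -- strict predecessor a₀ of b: a₀ survives DROP_b and precedes c, so a₀ = c,
  -- and then b = c by antisymmetry.
  depth0-afterDrop : (G : Graph S) → BoxLaws G → (b c : V G) → Bang G b → Bang G c → StrictPred G b →
                     (pc : T (otherThan G b c)) → Depth0 (DROP G b) (c , pc) → Depth0 G c
  depth0-afterDrop G I b c bb bc (a0 , a0≢b , a0b) pc d = depth0⁺ G c onlyC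
    where
      fromDrop : ∀ a → a ≢ b → InBox G a c → a ≡ c
      fromDrop a ne t = cong proj₁ (depth0⁻ (DROP G b) (c , pc) d (a , T-not⁺ (λ u → ne (toWitness {a? = _≟V_ G a b} u)))
                                             (subst T (sym (inB-fullSub G (otherThan G b) _ _)) t))
      onlyC : ∀ a → InBox G a c → a ≡ c
      onlyC a t with _≟V_ G a b
      ... | no ne = fromDrop a ne t
      ... | yes refl = ⊥-elim (otherThan-≢ G a c pc (anti I a c bb bc t (subst (λ z → InBox G z a) a0≡c a0b)))
        where
          a0≡c : a0 ≡ c
          a0≡c = fromDrop a0 a0≢b (nest I a0 a c (box-bang G a0 a bb a0b) bb a0b t)

  depth0-afterCopy : (G : Graph S) (b c : V G) → Depth0 (COPY G b) (inj₁ c) → ∀ a → InBox G a c → a ≡ c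
  depth0-afterCopy G b c d a t =
    inj₁-injective (depth0⁻ (COPY G b) (inj₁ c) d (inj₁ a) (subst T (sym (inB-copy₁₁ G b a c)) t))

  depth0-outside : (G : Graph S) (b c : V G) → c ≢ b → Depth0 (COPY G b) (inj₁ c) → ¬ InBox G b c
  depth0-outside G b c ne d t = ne (sym (depth0-afterCopy G b c d b t))

  depth0-firstCopy : (G : Graph S) (b : V G) (pb : InBox G b b) → (∀ a → InBox G a b → a ≡ b) →
                     ∀ x → InBox (EXP G b pb) x (inj₁ b , expKeep-first G b b pb) → x ≡ (inj₁ b , expKeep-first G b b pb)
  depth0-firstCopy G b pb h (inj₁ a , pa) t =
    ΣT-≡ {p = expKeep G b pb}
         (cong inj₁ (h a (subst T (inB-copy₁₁ G b a b) (subst T (inB-fullSub (COPY G b) (expKeep G b pb) _ _) t))))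
  depth0-firstCopy G b pb h (inj₂ (a , qa) , pa) t =
    ⊥-elim (proj₂ (inB-copy₂₁ G b (a , qa) b (subst T (inB-fullSub (COPY G b) (expKeep G b pb) _ _) t)) pb)

  -- A second copy of depth 0 must be the copy of b itself (b¹ ∈ B(b¹) reaches
  -- every second copy), and then b has depth 0.
  depth0-secondCopy : (G : Graph S) (b c : V G) (pb : InBox G b b) (q : InBox G b c) →
                      Depth0 (COPY G b) (inj₂ (c , q)) → b ≡ c
  depth0-secondCopy G b c pb q d =
    cong proj₁ (inj₂-injective (depth0⁻ (COPY G b) (inj₂ (c , q)) d (inj₂ (b , pb))
                                        (subst T (sym (inB-copy₂₂ G b (b , pb) (c , q))) q)))

  depth0-secondSelf : (G : Graph S) (b : V G) (q : InBox G b b) → Depth0 (COPY G b) (inj₂ (b , q)) →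
                      ∀ a → InBox G a b → a ≡ b
  depth0-secondSelf G b q d a t with T? (inB G b a)
  ... | yes qa = cong proj₁ (inj₂-injective (depth0⁻ (COPY G b) _ d (inj₂ (a , qa))
                                                    (subst T (sym (inB-copy₂₂ G b (a , qa) (b , q))) t)))
  ... | no na = ⊥-elim (inj₁≢inj₂ (depth0⁻ (COPY G b) _ d (inj₁ a) (inB-copy₁₂⁺ G b a (b , q) t na)))

  predBound-firstCopy : (G : Graph S) (b : V G) (pb : InBox G b b) → (∀ a → InBox G a b → a ≡ b) →
                        {n : ℕ} → PredBound (EXP G b pb) (inj₁ b , expKeep-first G b b pb) n
  predBound-firstCopy G b pb h = predBound [] z≤n (λ x ne t → ⊥-elim (ne (depth0-firstCopy G b pb h x t)))

  -- push{Kill,Drop,Copy} n m b r: given an ENF instantiation r of H from the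
  -- result of an operation on the !-vertex b, produce one from G.  The recursion is
  -- on (n, m) lexicographically: m bounds the length of r, n the number of
  -- strict predecessors of b; splitting b under EXP_c yields a copy with
  -- fewer predecessors, pushed into the result of pushing the other copy.
  module Normalise {H : Graph S} (concrete : IsConcrete H) where

    ENF : Graph S → Set₁
    ENF G = ENFInstantiation G H

    pushKill : ∀ n m {G} → BoxLaws G → (b : V G) → Bang G b → PredBound G b n →
               (r : ENF (KILL G b)) → enfLength r ≤ m → ENF G
    pushKill-kill : ∀ n m {G} → BoxLaws G → (b c : V G) → Bang G b → Bang G c → PredBound G b n →
                    (pc : T (outsideBox G b c)) → Depth0 G c →
                    (rest : ENF (KILL (KILL G b) (c , pc))) → enfLength rest ≤ m → ENF G
    pushKill-exp : ∀ n m {G} → BoxLaws G → (b c : V G) → Bang G b → Bang G c → PredBound G b n →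
                   (pc : T (outsideBox G b c)) → Depth0 G c → (p : InBox (KILL G b) (c , pc) (c , pc)) →
                   (rest : ENF (EXP (KILL G b) (c , pc) p)) → enfLength rest ≤ m → ENF G
    -- b ∈ B(c): after EXP_c, KILL both copies of b; the second has fewer predecessors
    pushKill-split : ∀ n m {G} (I : BoxLaws G) (b c : V G) (bb : Bang G b) (bc : Bang G c) → PredBound G b n →
                     (pc : T (outsideBox G b c)) (p : InBox (KILL G b) (c , pc) (c , pc)) →
                     InBox G c b → b ≢ c → (rest : ENF (EXP (KILL G b) (c , pc) p)) → enfLength rest ≤ m →
                     ENF (EXP G c (loop I c bc))

    pushKill′ : ∀ n {G} → BoxLaws G → (b : V G) → Bang G b → PredBound G b n → ENF (KILL G b) → ENF G
    pushKill′ n I b bb P r = pushKill n (enfLength r) I b bb P r ≤-refl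

    pushKill n m {G} I b bb P r lr with strictPred? G b
    pushKill n m {G} I b bb P r lr | inj₂ d0 = kill b bb (depth0⁺ G b d0) r
    pushKill n m {G} I b bb P (done J) lr | inj₁ (a , a≢b , ab) =
      ⊥-elim (concrete-noBang concrete J (a , T-not⁺ (λ t → a≢b (anti I a b (box-bang G a b bb ab) bb ab t)))
                                         (box-bang G a b bb ab))
    pushKill n (suc m) {G} I b bb P (kill (c , pc) bc d0c rest) (s≤s lr) | inj₁ _ =
      pushKill-kill n m I b c bb bc P pc (depth0-afterKill G I b c bb bc pc d0c) rest lr
    pushKill n (suc m) {G} I b bb P (exp (c , pc) bc d0c p rest) (s≤s lr) | inj₁ _ =
      pushKill-exp n m I b c bb bc P pc (depth0-afterKill G I b c bb bc pc d0c) p rest lr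

    pushKill-kill n m {G} I b c bb bc P pc d0 rest lr with T? (inB G c b)
    ... | yes c∋b = kill c bc d0 (enf-transport rest (killKill-absorb G I b c bb bc pc c∋b))
    ... | no c∌b = kill c bc d0
      (pushKill n m (boxLaws-fullSub G (outsideBox G c) I) (b , T-not⁺ c∌b) bb (predBound-fullSub G _ b _ P)
         (enf-transport rest (killKill-swap G b c pc c∌b)) (enf-transport-≤ rest _ lr))

    pushKill-exp n m {G} I b c bb bc P pc d0 p rest lr with T? (inB G c b)
    ... | yes c∋b = exp c bc d0 (loop I c bc)
      (pushKill-split n m I b c bb bc P pc p c∋b (outsideBox-≢ G I b c bb pc) rest lr)
    ... | no c∌b = exp c bc d0 (loop I c bc)
      (pushKill n m (boxLaws-EXP G c bc I (loop I c bc)) (inj₁ b , _) bb (predBound-expFirst G I c b bc bb _ P)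
         (enf-transport rest (expKill-swap G b c pc p (loop I c bc) c∌b)) (enf-transport-≤ rest _ lr))

    pushKill-split zero m I b c bb bc P pc p c∋b ne rest lr = ⊥-elim (predBound-zero P (λ e → ne (sym e)) c∋b)
    pushKill-split (suc n) m {G} I b c bb bc P pc p c∋b ne rest lr =
      pushKill′ n IX b₂ bb (predBound-expSecond G c b p0 c∋b ne P)
        (pushKill (suc n) m (boxLaws-fullSub X (outsideBox X b₂) IX) (b₁ , b₂∌b₁) bb
           (predBound-fullSub X _ b₁ b₂∌b₁ (predBound-expFirst G I c b bc bb p0 P))
           (enf-transport rest (expKill-split G I b c bb bc pc p p0 c∋b ne b₂∌b₁)) (enf-transport-≤ rest _ lr))
      where
        p0 : InBox G c c
        p0 = loop I c bc
        X : Graph S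
        X = EXP G c p0
        IX : BoxLaws X
        IX = boxLaws-EXP G c bc I p0
        b₁ b₂ : V X
        b₁ = inj₁ b , expKeep-first G c b p0
        b₂ = inj₂ (b , c∋b) , expKeep-second G c b p0 c∋b ne
        b₂∌b₁ : T (outsideBox X b₂ b₁)
        b₂∌b₁ = T-not⁺ (λ t → proj₂ (inB-copy₂₁ G c (b , c∋b) b
                                        (subst T (inB-fullSub (COPY G c) (expKeep G c p0) b₂ b₁) t)) c∋b)

    dropAsExpKill : ∀ {G} → BoxLaws G → (b : V G) → Bang G b → (∀ a → InBox G a b → a ≡ b) →
                    ENF (DROP G b) → ENF G
    dropAsExpKill {G} I b bb d0 r =
      exp b bb (depth0⁺ G b d0) (loop I b bb)
        (kill (inj₁ b , expKeep-first G b b (loop I b bb)) bb (depth0⁺ (EXP G b _) _ (depth0-firstCopy G b _ d0))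
          (enf-transport r (isoSym (killExp-drop G b (loop I b bb)))))

    pushDrop : ∀ n m {G} → BoxLaws G → (b : V G) → Bang G b → PredBound G b n →
               (r : ENF (DROP G b)) → enfLength r ≤ m → ENF G
    pushDrop-kill : ∀ n m {G} → BoxLaws G → (b c : V G) → Bang G b → Bang G c → PredBound G b n →
                    (pc : T (otherThan G b c)) → Depth0 G c →
                    (rest : ENF (KILL (DROP G b) (c , pc))) → enfLength rest ≤ m → ENF G
    pushDrop-exp : ∀ n m {G} → BoxLaws G → (b c : V G) → Bang G b → Bang G c → PredBound G b n →
                   (pc : T (otherThan G b c)) → Depth0 G c → (p : InBox (DROP G b) (c , pc) (c , pc)) →
                   (rest : ENF (EXP (DROP G b) (c , pc) p)) → enfLength rest ≤ m → ENF G
    pushDrop-split : ∀ n m {G} (I : BoxLaws G) (b c : V G) (bb : Bang G b) (bc : Bang G c) → PredBound G b n →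
                     (pc : T (otherThan G b c)) (p : InBox (DROP G b) (c , pc) (c , pc)) →
                     InBox G c b → b ≢ c → (rest : ENF (EXP (DROP G b) (c , pc) p)) → enfLength rest ≤ m →
                     ENF (EXP G c (loop I c bc))

    pushDrop′ : ∀ n {G} → BoxLaws G → (b : V G) → Bang G b → PredBound G b n → ENF (DROP G b) → ENF G
    pushDrop′ n I b bb P r = pushDrop n (enfLength r) I b bb P r ≤-refl

    pushDrop n m {G} I b bb P r lr with strictPred? G b
    pushDrop n m {G} I b bb P r lr | inj₂ d0 = dropAsExpKill I b bb d0 r
    pushDrop n m {G} I b bb P (done J) lr | inj₁ (a , a≢b , ab) =
      ⊥-elim (concrete-noBang concrete J (a , T-not⁺ (λ t → a≢b (toWitness {a? = _≟V_ G a b} t)))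
                                         (box-bang G a b bb ab))
    pushDrop n (suc m) {G} I b bb P (kill (c , pc) bc d0c rest) (s≤s lr) | inj₁ sp =
      pushDrop-kill n m I b c bb bc P pc (depth0-afterDrop G I b c bb bc sp pc d0c) rest lr
    pushDrop n (suc m) {G} I b bb P (exp (c , pc) bc d0c p rest) (s≤s lr) | inj₁ sp =
      pushDrop-exp n m I b c bb bc P pc (depth0-afterDrop G I b c bb bc sp pc d0c) p rest lr

    pushDrop-kill n m {G} I b c bb bc P pc d0 rest lr with T? (inB G c b)
    ... | yes c∋b = kill c bc d0 (enf-transport rest (killDrop-absorb G b c pc c∋b))
    ... | no c∌b = kill c bc d0
      (pushDrop n m (boxLaws-fullSub G (outsideBox G c) I) (b , T-not⁺ c∌b) bb (predBound-fullSub G _ b _ P)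
         (enf-transport rest (killDrop-swap G b c pc c∌b)) (enf-transport-≤ rest _ lr))

    pushDrop-exp n m {G} I b c bb bc P pc d0 p rest lr with T? (inB G c b)
    ... | yes c∋b = exp c bc d0 (loop I c bc)
      (pushDrop-split n m I b c bb bc P pc p c∋b (otherThan-≢ G b c pc) rest lr)
    ... | no c∌b = exp c bc d0 (loop I c bc)
      (pushDrop n m (boxLaws-EXP G c bc I (loop I c bc)) (inj₁ b , _) bb (predBound-expFirst G I c b bc bb _ P)
         (enf-transport rest (expDrop-swap G b c pc p (loop I c bc) c∌b)) (enf-transport-≤ rest _ lr))

    pushDrop-split zero m I b c bb bc P pc p c∋b ne rest lr = ⊥-elim (predBound-zero P (λ e → ne (sym e)) c∋b)
    pushDrop-split (suc n) m {G} I b c bb bc P pc p c∋b ne rest lr =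
      pushDrop′ n IX b₂ bb (predBound-expSecond G c b p0 c∋b ne P)
        (pushDrop (suc n) m (boxLaws-fullSub X (otherThan X b₂) IX) (b₁ , b₂≠b₁) bb
           (predBound-fullSub X _ b₁ b₂≠b₁ (predBound-expFirst G I c b bc bb p0 P))
           (enf-transport rest (expDrop-split G b c pc p p0 c∋b ne b₂≠b₁)) (enf-transport-≤ rest _ lr))
      where
        p0 : InBox G c c
        p0 = loop I c bc
        X : Graph S
        X = EXP G c p0
        IX : BoxLaws X
        IX = boxLaws-EXP G c bc I p0
        b₁ b₂ : V X
        b₁ = inj₁ b , expKeep-first G c b p0
        b₂ = inj₂ (b , c∋b) , expKeep-second G c b p0 c∋b ne
        b₂≠b₁ : T (otherThan X b₂ b₁)
        b₂≠b₁ = T-not⁺ (λ t → inj₁≢inj₂ (cong proj₁ (toWitness {a? = _≟V_ X b₁ b₂} t)))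

    -- COPY_b: an ENF step on a copy of b itself undoes or re-creates the copy
    pushCopy : ∀ n m {G} → BoxLaws G → (b : V G) → Bang G b → PredBound G b n →
               (r : ENF (COPY G b)) → enfLength r ≤ m → ENF G
    pushCopy-kill : ∀ n m {G} → BoxLaws G → (b c : V G) → Bang G b → Bang G c → PredBound G b n →
                    Depth0 (COPY G b) (inj₁ c) →
                    (rest : ENF (KILL (COPY G b) (inj₁ c))) → enfLength rest ≤ m → ENF G
    pushCopy-exp : ∀ n m {G} → BoxLaws G → (b c : V G) → Bang G b → Bang G c → PredBound G b n →
                   Depth0 (COPY G b) (inj₁ c) → (p : InBox (COPY G b) (inj₁ c) (inj₁ c)) →
                   (rest : ENF (EXP (COPY G b) (inj₁ c) p)) → enfLength rest ≤ m → ENF G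
    pushCopy-split : ∀ n m {G} (I : BoxLaws G) (b c : V G) (bb : Bang G b) (bc : Bang G c) → PredBound G b n →
                     ¬ InBox G b c → (p : InBox (COPY G b) (inj₁ c) (inj₁ c)) → InBox G c b → b ≢ c →
                     (rest : ENF (EXP (COPY G b) (inj₁ c) p)) → enfLength rest ≤ m → ENF (EXP G c (loop I c bc))

    pushCopy′ : ∀ n {G} → BoxLaws G → (b : V G) → Bang G b → PredBound G b n → ENF (COPY G b) → ENF G
    pushCopy′ n I b bb P r = pushCopy n (enfLength r) I b bb P r ≤-refl

    pushCopy n m {G} I b bb P (done J) lr = ⊥-elim (concrete-noBang concrete J (inj₁ b) bb)
    pushCopy n (suc m) {G} I b bb P (kill (inj₁ c) bc d0c rest) (s≤s lr) = pushCopy-kill n m I b c bb bc P d0c rest lr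
    pushCopy n (suc m) {G} I b bb P (kill (inj₂ (c , q)) bc d0c rest) (s≤s lr)
      with depth0-secondCopy G b c (loop I b bb) q d0c
    ... | refl = enf-transport rest (killCopy-secondSelf G I b bb q)
    pushCopy n (suc m) {G} I b bb P (exp (inj₁ c) bc d0c p rest) (s≤s lr) = pushCopy-exp n m I b c bb bc P d0c p rest lr
    pushCopy n (suc m) {G} I b bb P (exp (inj₂ (c , q)) bc d0c p rest) (s≤s lr)
      with depth0-secondCopy G b c (loop I b bb) q d0c
    ... | refl = exp b bb (depth0⁺ G b (depth0-secondSelf G b q d0c)) (loop I b bb)
      (pushCopy n m (boxLaws-EXP G b bb I (loop I b bb)) (inj₁ b , _) bb
         (predBound-firstCopy G b (loop I b bb) (depth0-secondSelf G b q d0c))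
         (enf-transport rest (expCopy-selfSecond G b (loop I b bb) q p)) (enf-transport-≤ rest _ lr))

    pushCopy-kill n m {G} I b c bb bc P d0c rest lr with _≟V_ G c b | T? (inB G c b)
    ... | yes refl | _ = enf-transport rest (killCopy-firstSelf G I b bb)
    ... | no c≢b | yes c∋b =
      kill c bc (depth0⁺ G c (depth0-afterCopy G b c d0c))
        (enf-transport rest (killCopy-absorb G I b c bb bc (depth0-outside G b c c≢b d0c) c∋b))
    ... | no c≢b | no c∌b =
      kill c bc (depth0⁺ G c (depth0-afterCopy G b c d0c))
        (pushCopy n m (boxLaws-fullSub G (outsideBox G c) I) (b , T-not⁺ c∌b) bb (predBound-fullSub G _ b _ P)
           (enf-transport rest (killCopy-swap G b c (depth0-outside G b c c≢b d0c) c∌b)) (enf-transport-≤ rest _ lr))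

    pushCopy-exp n m {G} I b c bb bc P d0c p rest lr with _≟V_ G c b | T? (inB G c b)
    ... | yes refl | _ =
      exp b bb (depth0⁺ G b (depth0-afterCopy G b b d0c)) (loop I b bb)
        (pushCopy n m (boxLaws-EXP G b bb I (loop I b bb)) (inj₁ b , _) bb
           (predBound-firstCopy G b (loop I b bb) (depth0-afterCopy G b b d0c))
           (enf-transport rest (ExchangeCopies.expCopy-self G b (loop I b bb) p)) (enf-transport-≤ rest _ lr))
    ... | no c≢b | yes c∋b =
      exp c bc (depth0⁺ G c (depth0-afterCopy G b c d0c)) (loop I c bc)
        (pushCopy-split n m I b c bb bc P (depth0-outside G b c c≢b d0c) p c∋b (λ e → c≢b (sym e)) rest lr)
    ... | no c≢b | no c∌b =
      exp c bc (depth0⁺ G c (depth0-afterCopy G b c d0c)) (loop I c bc)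
        (pushCopy n m (boxLaws-EXP G c bc I (loop I c bc)) (inj₁ b , _) bb (predBound-expFirst G I c b bc bb _ P)
           (enf-transport rest (expCopy-swap G b c (depth0-outside G b c c≢b d0c) c∌b p (loop I c bc)))
           (enf-transport-≤ rest _ lr))

    pushCopy-split zero m I b c bb bc P b∌c p c∋b ne rest lr = ⊥-elim (predBound-zero P (λ e → ne (sym e)) c∋b)
    pushCopy-split (suc n) m {G} I b c bb bc P b∌c p c∋b ne rest lr =
      pushCopy′ n IX b₂ bb (predBound-expSecond G c b p0 c∋b ne P)
        (pushCopy (suc n) m (boxLaws-COPY X b₂ bb IX) (inj₁ b₁) bb
           (predBound-copyFirst X IX b₂ b₁ bb bb (predBound-expFirst G I c b bc bb p0 P))
           (enf-transport rest (expCopy-split G I b c bb bc b∌c c∋b ne p p0)) (enf-transport-≤ rest _ lr))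
      where
        p0 : InBox G c c
        p0 = loop I c bc
        X : Graph S
        X = EXP G c p0
        IX : BoxLaws X
        IX = boxLaws-EXP G c bc I p0
        b₁ b₂ : V X
        b₁ = inj₁ b , expKeep-first G c b p0
        b₂ = inj₂ (b , c∋b) , expKeep-second G c b p0 c∋b ne

    normalise : ∀ {G} → BoxLaws G → Instantiation G H → ENF G
    normalise I (done J) = done J
    normalise {G} I (step (copy b bb) rest) =
      pushCopy′ _ I b bb (predBound-all G b) (normalise (boxLaws-COPY G b bb I) rest)
    normalise {G} I (step (drop b bb) rest) =
      pushDrop′ _ I b bb (predBound-all G b) (normalise (boxLaws-fullSub G (otherThan G b) I) rest)
    normalise {G} I (step (kill b bb) rest) =
      pushKill′ _ I b bb (predBound-all G b) (normalise (boxLaws-fullSub G (outsideBox G b) I) rest)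

theorem6p13 : (S : Sig) (G H : Graph S) → IsBangGraph G → IsConcrete H →
              Instantiation G H → ENFInstantiation G H
theorem6p13 S G H bangGraph concrete inst = Normalise.normalise concrete (bangGraph-boxLaws G bangGraph) inst
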